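{- The posets $P_{n,0}$ (for $n\ge1$), $P_{n,1}$ (for $n\ge2$), and $P_{n,n-1}$ (for $n\ge1$) each admit a normalized flow, and hence are strongly Sperner.
   Context: A projective sign vector of length $n$ is an element of $\{0,+,-\}^n\setminus\{(0,\dots,0)\}$ modulo $(v_1,\dots,v_n)\sim(-v_1,\dots,-v_n)$; its number of sign changes is the number of sign changes in the sequence of its nonzero entries. For $0\le l<n$, $P_{n,l}$ is the poset of projective sign vectors of length $n$ with at most $l$ sign changes, with $v\le w$ iff for suitable representatives $v_i\in\{0,w_i\}$ for all $i$; it is graded with ranks $1,\dots,n$, rank being the number of nonzero entries. For a finite graded poset $P$ with ranks $1,\dots,d$ and $W_r$ elements of rank $r$: a normalized flow is a function $f$ from cover relations to $\mathbb{R}_{\ge0}$ such that for each $1\le r\le d-1$, (NF1) $\sum_{y:\,x\lessdot y}f(x\lessdot y)$ is the same positive number for all $x$ of rank $r$, and (NF2) $\sum_{x:\,x\lessdot y}f(x\lessdot y)$ is the same positive number for all $y$ of rank $r+1$. $P$ is strongly Sperner if for every $j\ge1$ and all antichains $A_1,\dots,A_j$, $|A_1\cup\cdots\cup A_j|\le\max_{1\le r_1<\cdots<r_j\le d}(W_{r_1}+\cdots+W_{r_j})$. -}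

module Defs where

open import Data.Nat as ℕ using (ℕ; zero; suc; _+_; _∸_)
open import Data.List using (List; []; _∷_; length; filter; map; concat; foldr; deduplicate)
open import Data.List.Relation.Unary.All as All using (All)
open import Data.List.Relation.Unary.Linked using (Linked)
open import Data.List.Membership.Propositional using (_∈_)
open import Data.Vec using (Vec; []; _∷_)
open import Data.Vec.Properties using (≡-dec)
open import Data.Vec.Relation.Binary.Pointwise.Inductive as PW using (Pointwise)
open import Data.Maybe using (Maybe; just; nothing)
open import Data.Product using (Σ; ∃; _×_; _,_)
open import Data.Sum using (_⊎_)
open import Data.Rational as ℚ using (ℚ; 0ℚ)
open import Relation.Binary.PropositionalEquality using (_≡_; _≢_; refl)
open import Relation.Binary.Definitions using (Decidable; DecidableEquality)
open import Relation.Nullary using (Dec; yes; no; ¬_; ¬?)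
open import Relation.Nullary.Decidable using (_×-dec_; _⊎-dec_; _→-dec_)

-- Finite graded posets, given by an explicit (duplicate-free) enumeration
-- of their elements inside an ambient type with decidable equality.

record FinGradedPoset : Set₁ where
  field
    Carrier : Set
    _≟_     : DecidableEquality Carrier
    _≤_     : Carrier → Carrier → Set
    _≤?_    : Decidable _≤_
    elems   : List Carrier
    rank    : Carrier → ℕ
    d       : ℕ                     -- ranks are 1, …, d

module _ (P : FinGradedPoset) where
  open FinGradedPoset P

  _⋖_ : Carrier → Carrier → Set
  x ⋖ y = x ≤ y × x ≢ y ×
          All (λ z → x ≤ z → z ≤ y → (z ≡ x ⊎ z ≡ y)) elems

  _⋖?_ : Decidable _⋖_
  x ⋖? y = (x ≤? y) ×-dec ((¬? (x ≟ y)) ×-dec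
           All.all? (λ z → (x ≤? z) →-dec ((z ≤? y) →-dec ((z ≟ x) ⊎-dec (z ≟ y)))) elems)

  sumℚ : List ℚ → ℚ
  sumℚ = foldr ℚ._+_ 0ℚ

  outFlow : (Carrier → Carrier → ℚ) → Carrier → ℚ
  outFlow f x = sumℚ (map (f x) (filter (x ⋖?_) elems))

  inFlow : (Carrier → Carrier → ℚ) → Carrier → ℚ
  inFlow f y = sumℚ (map (λ x → f x y) (filter (_⋖? y) elems))

  -- f is a (nonnegative rational-valued) normalized flow; f is only
  -- consulted on cover relations.
  IsNormalizedFlow : (Carrier → Carrier → ℚ) → Set
  IsNormalizedFlow f =
    (∀ x y → x ∈ elems → y ∈ elems → x ⋖ y → 0ℚ ℚ.≤ f x y) ×
    (∀ r → 1 ℕ.≤ r → r ℕ.< d →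
       (∃ λ c → 0ℚ ℚ.< c × (∀ x → x ∈ elems → rank x ≡ r → outFlow f x ≡ c))
     × (∃ λ c → 0ℚ ℚ.< c × (∀ y → y ∈ elems → rank y ≡ suc r → inFlow f y ≡ c)))

  HasNormalizedFlow : Set
  HasNormalizedFlow = Σ (Carrier → Carrier → ℚ) IsNormalizedFlow

  W : ℕ → ℕ
  W r = length (filter (λ x → rank x ℕ.≟ r) elems)

  IsAntichain : List Carrier → Set
  IsAntichain A = All (_∈ elems) A × (∀ x y → x ∈ A → y ∈ A → x ≤ y → x ≡ y)

  unionSize : List (List Carrier) → ℕ
  unionSize As = length (deduplicate _≟_ (concat As))

  -- |A₁ ∪ ⋯ ∪ Aⱼ| ≤ max_{1 ≤ r₁ < ⋯ < rⱼ ≤ d} (W_{r₁} + ⋯ + W_{rⱼ}),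
  -- written as: some admissible choice r₁ < ⋯ < rⱼ attains the bound.
  StronglySperner : Set
  StronglySperner =
    ∀ (j : ℕ) → 1 ℕ.≤ j → j ℕ.≤ d →
    (As : List (List Carrier)) → length As ≡ j → All IsAntichain As →
    ∃ λ (rs : List ℕ) → length rs ≡ j × Linked ℕ._<_ rs ×
      All (λ r → 1 ℕ.≤ r × r ℕ.≤ d) rs ×
      unionSize As ℕ.≤ foldr _+_ 0 (map W rs)

data Sign : Set where
  𝟎 ⊕ ⊖ : Sign

_≟ˢ_ : DecidableEquality Sign
𝟎 ≟ˢ 𝟎 = yes refl
𝟎 ≟ˢ ⊕ = no λ ()
𝟎 ≟ˢ ⊖ = no λ ()
⊕ ≟ˢ 𝟎 = no λ ()
⊕ ≟ˢ ⊕ = yes refl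
⊕ ≟ˢ ⊖ = no λ ()
⊖ ≟ˢ 𝟎 = no λ ()
⊖ ≟ˢ ⊕ = no λ ()
⊖ ≟ˢ ⊖ = yes refl

negˢ : Sign → Sign
negˢ 𝟎 = 𝟎
negˢ ⊕ = ⊖
negˢ ⊖ = ⊕

nonzeros : ∀ {n} → Vec Sign n → List Sign
nonzeros []       = []
nonzeros (𝟎 ∷ v) = nonzeros v
nonzeros (⊕ ∷ v) = ⊕ ∷ nonzeros v
nonzeros (⊖ ∷ v) = ⊖ ∷ nonzeros v

changesFrom : Sign → List Sign → ℕ
changesFrom x []      = 0
changesFrom x (y ∷ s) with x ≟ˢ y
... | yes _ = changesFrom y s
... | no  _ = suc (changesFrom y s)

changes : List Sign → ℕ
changes []      = 0
changes (x ∷ s) = changesFrom x s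

signChanges : ∀ {n} → Vec Sign n → ℕ
signChanges v = changes (nonzeros v)

headMaybe : List Sign → Maybe Sign
headMaybe []      = nothing
headMaybe (x ∷ _) = just x

-- A projective sign vector (nonzero sign vector modulo v ∼ -v) is
-- represented by its unique representative whose first nonzero entry is +.
IsCanonical : ∀ {n} → Vec Sign n → Set
IsCanonical v = headMaybe (nonzeros v) ≡ just ⊕

isCanonical? : ∀ {n} (v : Vec Sign n) → Dec (IsCanonical v)
isCanonical? v with headMaybe (nonzeros v)
... | just ⊕ = yes refl
... | just 𝟎 = no λ ()
... | just ⊖ = no λ ()
... | nothing = no λ ()

allSignVecs : (n : ℕ) → List (Vec Sign n)
allSignVecs zero    = [] ∷ []
allSignVecs (suc n) = concat (map (λ s → map (s ∷_) (allSignVecs n)) (𝟎 ∷ ⊕ ∷ ⊖ ∷ []))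

InP : ∀ {n} → ℕ → Vec Sign n → Set
InP l v = IsCanonical v × signChanges v ℕ.≤ l

inP? : ∀ {n} (l : ℕ) → (v : Vec Sign n) → Dec (InP l v)
inP? l v = isCanonical? v ×-dec (signChanges v ℕ.≤? l)

-- v ≤ w iff for suitable representatives v_i ∈ {0, w_i} for all i
-- (representatives of v are v, -v; it suffices to flip one side)
SignLeq : ∀ {n} → Vec Sign n → Vec Sign n → Set
SignLeq v w = Pointwise (λ a b → a ≡ 𝟎 ⊎ a ≡ b) v w
            ⊎ Pointwise (λ a b → a ≡ 𝟎 ⊎ a ≡ negˢ b) v w

signLeq? : ∀ {n} → Decidable (SignLeq {n})
signLeq? v w = PW.decidable (λ a b → (a ≟ˢ 𝟎) ⊎-dec (a ≟ˢ b)) v w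
        ⊎-dec PW.decidable (λ a b → (a ≟ˢ 𝟎) ⊎-dec (a ≟ˢ negˢ b)) v w

P : (n l : ℕ) → FinGradedPoset
P n l = record
  { Carrier = Vec Sign n
  ; _≟_     = ≡-dec _≟ˢ_
  ; _≤_     = SignLeq
  ; _≤?_    = signLeq?
  ; elems   = filter (inP? l) (allSignVecs n)
  ; rank    = λ v → length (nonzeros v)
  ; d       = n
  }

-- Each poset carries an explicit flow with values in ℕ: the constant flow 1 on
-- P n 0 and P n (n ∸ 1), and on P n 1 the flow 1 or 2 along x ⋖ y according as
-- the twin of y (its new coordinate negated) does or does not lie in P n 1.
-- Such a flow is normalized, and it makes any ranked poset strongly Sperner:
-- double counting the flow between ranks r and r + 1 gives W r · up r =
-- W (r + 1) · down r, so the weights T r = (down 1 ⋯ down (r - 1)) · (up r ⋯ up (d - 1))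
-- satisfy W r · T r = Ω for every r. Following the flow upward along maximal
-- chains gives the LYM inequality ∑_{a ∈ A} T (rank a) ≤ Ω for each antichain A;
-- adding this up for j antichains and comparing with the j ranks of largest W
-- bounds the size of their union.

module Submission where

open import Defs
open import Data.Bool using (Bool; true; false; not; _∧_; _∨_; if_then_else_; T)
open import Data.Bool.Properties using (∨-zeroʳ)
open import Data.Empty using (⊥; ⊥-elim)
open import Data.List using (List; []; _∷_; _++_; map; filter; length; foldr; concat; deduplicate; applyUpTo)
open import Data.List.Properties using (map-++; length-map; length-applyUpTo)
open import Data.List.Extrema.Nat using (argmax; argmax-sel; f[⊥]≤f[argmax]; f[xs]≤f[argmax]; max; xs≤max; max≤v⁺)
open import Data.List.Membership.Propositional using (_∈_; _∉_)
open import Data.List.Membership.Propositional.Properties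
  using (∈-filter⁻; ∈-filter⁺; ∈-map⁺; ∈-map⁻; ∈-++⁺ˡ; ∈-++⁺ʳ; ∈-++⁻; ∈-concat⁻′; ∈-concat⁺′; ∈-deduplicate⁻; ∈-deduplicate⁺; ∈-applyUpTo⁺; ∈-applyUpTo⁻)
import Data.List.Membership.DecPropositional as DecMembership
open import Data.List.Relation.Binary.Sublist.Propositional using (_⊆_; []; _∷_; _∷ʳ_)
open import Data.List.Relation.Binary.Sublist.Propositional.Properties using (length-mono-≤)
open import Data.List.Relation.Unary.All as All using (All; []; _∷_)
import Data.List.Relation.Unary.All.Properties as All using (map⁺)
open import Data.List.Relation.Unary.AllPairs using ([]; _∷_)
open import Data.List.Relation.Unary.Any using (here; there)
open import Data.List.Relation.Unary.Linked using (Linked)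
import Data.List.Relation.Unary.Linked.Properties as Linked
open import Data.List.Relation.Unary.Unique.Propositional using (Unique)
import Data.List.Relation.Unary.Unique.Propositional.Properties as Unique
import Data.List.Relation.Unary.Unique.DecPropositional.Properties as UniqueDec
open import Data.Maybe using (Maybe; just; nothing)
open import Data.Nat as ℕ using (ℕ; zero; suc; _+_; _*_; _∸_; _≤_; _<_; z≤n; s≤s; _≤?_; _≟_; _≡ᵇ_; _≤ᵇ_)
open import Data.Nat.ListAction using (sum)
open import Data.Nat.ListAction.Properties using (sum-++)
open import Data.Nat.Properties
open import Data.Nat.Tactic.RingSolver using (solve-∀)
open import Data.Product using (Σ; ∃; _×_; _,_; proj₁; proj₂)
open import Data.Rational as ℚ using (ℚ; 0ℚ; 1ℚ)
import Data.Rational.Properties as ℚ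
open import Data.Sum using (_⊎_; inj₁; inj₂; [_,_]′)
open import Data.Unit using (tt)
open import Data.Vec as V using (Vec; []; _∷_)
open import Data.Vec.Relation.Binary.Pointwise.Inductive using (Pointwise; []; _∷_)
open import Relation.Binary.Definitions using (DecidableEquality)
open import Relation.Binary.PropositionalEquality
open import Relation.Nullary using (Dec; yes; no; does; ¬_; ¬?)
open import Relation.Nullary.Decidable using (toWitness)
open import Relation.Unary using (Pred; Decidable)

-- Finite sums

𝟙 : Bool → ℕ
𝟙 true  = 1
𝟙 false = 0

𝟙≤1 : ∀ b → 𝟙 b ≤ 1
𝟙≤1 true  = s≤s z≤n
𝟙≤1 false = z≤n

𝟙-yes : ∀ {p} {P : Set p} (P? : Dec P) → P → 𝟙 (does P?) ≡ 1
𝟙-yes (yes _) _ = refl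
𝟙-yes (no ¬p) p = ⊥-elim (¬p p)

𝟙-no : ∀ {p} {P : Set p} (P? : Dec P) → ¬ P → 𝟙 (does P?) ≡ 0
𝟙-no (yes p) ¬p = ⊥-elim (¬p p)
𝟙-no (no _)  _  = refl

𝟙-cong : ∀ {p q} {P : Set p} {Q : Set q} (P? : Dec P) (Q? : Dec Q) →
         (P → Q) → (Q → P) → 𝟙 (does P?) ≡ 𝟙 (does Q?)
𝟙-cong (yes p) (yes q) _ _ = refl
𝟙-cong (yes p) (no ¬q) f _ = ⊥-elim (¬q (f p))
𝟙-cong (no ¬p) (yes q) _ g = ⊥-elim (¬p (g q))
𝟙-cong (no ¬p) (no ¬q) _ _ = refl

module _ {a} {A : Set a} where

  ∑ : List A → (A → ℕ) → ℕ
  ∑ xs g = sum (map g xs)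

  ∑-++ : ∀ xs ys g → ∑ (xs ++ ys) g ≡ ∑ xs g + ∑ ys g
  ∑-++ xs ys g = trans (cong sum (map-++ g xs ys)) (sum-++ (map g xs) (map g ys))

  ∑-+ : ∀ xs g h → ∑ xs (λ x → g x + h x) ≡ ∑ xs g + ∑ xs h
  ∑-+ []       g h = refl
  ∑-+ (x ∷ xs) g h rewrite ∑-+ xs g h = interchange (g x) (h x) (∑ xs g) (∑ xs h)
    where
    interchange : ∀ a b c d → (a + b) + (c + d) ≡ (a + c) + (b + d)
    interchange = solve-∀

  ∑-*ˡ : ∀ xs c g → ∑ xs (λ x → c * g x) ≡ c * ∑ xs g
  ∑-*ˡ []       c g = sym (*-zeroʳ c)
  ∑-*ˡ (x ∷ xs) c g rewrite ∑-*ˡ xs c g = sym (*-distribˡ-+ c (g x) (∑ xs g))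

  ∑-*ʳ : ∀ xs c g → ∑ xs (λ x → g x * c) ≡ ∑ xs g * c
  ∑-*ʳ []       c g = refl
  ∑-*ʳ (x ∷ xs) c g rewrite ∑-*ʳ xs c g = sym (*-distribʳ-+ c (g x) (∑ xs g))

  ∑-cong : ∀ xs {g h} → (∀ x → x ∈ xs → g x ≡ h x) → ∑ xs g ≡ ∑ xs h
  ∑-cong []       e = refl
  ∑-cong (x ∷ xs) e = cong₂ _+_ (e x (here refl)) (∑-cong xs (λ y p → e y (there p)))

  ∑-mono-≤ : ∀ xs {g h} → (∀ x → x ∈ xs → g x ≤ h x) → ∑ xs g ≤ ∑ xs h
  ∑-mono-≤ []       e = z≤n
  ∑-mono-≤ (x ∷ xs) e = +-mono-≤ (e x (here refl)) (∑-mono-≤ xs (λ y p → e y (there p)))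

  ∑-const : ∀ xs c → ∑ xs (λ _ → c) ≡ length xs * c
  ∑-const []       c = refl
  ∑-const (x ∷ xs) c = cong (c +_) (∑-const xs c)

  ∑-zero : ∀ xs {g} → (∀ x → x ∈ xs → g x ≡ 0) → ∑ xs g ≡ 0
  ∑-zero xs e = trans (∑-cong xs e) (trans (∑-const xs 0) (*-zeroʳ (length xs)))

  ∑-1 : ∀ xs → ∑ xs (λ _ → 1) ≡ length xs
  ∑-1 xs = trans (∑-const xs 1) (*-identityʳ (length xs))

  term≤∑ : ∀ xs g {x} → x ∈ xs → g x ≤ ∑ xs g
  term≤∑ (y ∷ xs) g (here refl) = m≤m+n (g y) _
  term≤∑ (y ∷ xs) g (there p)   = ≤-trans (term≤∑ xs g p) (m≤n+m _ (g y))

  ∑-filter : ∀ {p} {P : Pred A p} (P? : Decidable P) xs g →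
             ∑ (filter P? xs) g ≡ ∑ xs (λ x → 𝟙 (does (P? x)) * g x)
  ∑-filter P? []       g = refl
  ∑-filter P? (x ∷ xs) g with does (P? x)
  ... | true  = cong₂ _+_ (sym (+-identityʳ (g x))) (∑-filter P? xs g)
  ... | false = ∑-filter P? xs g

  length-filter : ∀ {p} {P : Pred A p} (P? : Decidable P) xs →
                  length (filter P? xs) ≡ ∑ xs (λ x → 𝟙 (does (P? x)))
  length-filter P? xs = trans (sym (∑-1 (filter P? xs)))
    (trans (∑-filter P? xs (λ _ → 1)) (∑-cong xs (λ x _ → *-identityʳ (𝟙 (does (P? x))))))

  remove : ∀ {x : A} xs → x ∈ xs → List A
  remove (_ ∷ xs) (here _)  = xs
  remove (y ∷ xs) (there p) = y ∷ remove xs p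

  ∑-remove : ∀ {x : A} xs (p : x ∈ xs) g → ∑ xs g ≡ g x + ∑ (remove xs p) g
  ∑-remove (y ∷ xs) (here refl) g = refl
  ∑-remove {x} (y ∷ xs) (there p) g rewrite ∑-remove xs p g = +-assoc-comm (g y) (g x) _
    where
    +-assoc-comm : ∀ a b c → a + (b + c) ≡ b + (a + c)
    +-assoc-comm = solve-∀

  ∈-remove : ∀ {x y : A} xs (p : x ∈ xs) → y ∈ xs → y ≢ x → y ∈ remove xs p
  ∈-remove (z ∷ xs) (here refl) (here refl) y≢x = ⊥-elim (y≢x refl)
  ∈-remove (z ∷ xs) (here refl) (there q)   _   = q
  ∈-remove (z ∷ xs) (there p)   (here refl) _   = here refl
  ∈-remove (z ∷ xs) (there p)   (there q)   y≢x = there (∈-remove xs p q y≢x)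

  ∑-mono-⊆ : ∀ xs ys g → Unique xs → (∀ {x} → x ∈ xs → x ∈ ys) → ∑ xs g ≤ ∑ ys g
  ∑-mono-⊆ []       ys g _          _   = z≤n
  ∑-mono-⊆ (x ∷ xs) ys g (x∉ ∷ uxs) sub =
    ≤-trans (+-monoʳ-≤ (g x) (∑-mono-⊆ xs (remove ys x∈ys) g uxs
               (λ q → ∈-remove ys x∈ys (sub (there q)) (λ e → All.lookup x∉ q (sym e)))))
            (≤-reflexive (sym (∑-remove ys x∈ys g)))
    where x∈ys = sub (here refl)

  length-mono-⊆ : ∀ xs ys → Unique xs → (∀ {x} → x ∈ xs → x ∈ ys) → length xs ≤ length ys
  length-mono-⊆ xs ys uxs sub = subst₂ _≤_ (∑-1 xs) (∑-1 ys) (∑-mono-⊆ xs ys (λ _ → 1) uxs sub)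

module _ {a b} {A : Set a} {B : Set b} where

  ∑-swap : ∀ (xs : List A) (ys : List B) (h : A → B → ℕ) →
           ∑ xs (λ x → ∑ ys (h x)) ≡ ∑ ys (λ y → ∑ xs (λ x → h x y))
  ∑-swap []       ys h = sym (∑-zero ys (λ _ _ → refl))
  ∑-swap (x ∷ xs) ys h rewrite ∑-swap xs ys h = sym (∑-+ ys (h x) (λ y → ∑ xs (λ x′ → h x′ y)))

  ∑-map : ∀ (f : A → B) xs g → ∑ (map f xs) g ≡ ∑ xs (λ x → g (f x))
  ∑-map f []       g = refl
  ∑-map f (x ∷ xs) g = cong (g (f x) +_) (∑-map f xs g)

-- Choosing the heaviest ranks

module _ {A : Set} (_≟_ : DecidableEquality A) (w : A → ℕ) where
  open DecMembership _≟_ using (_∈?_)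

  heaviest : ∀ (x : A) xs → Σ A λ m → m ∈ x ∷ xs × (∀ {y} → y ∈ x ∷ xs → w y ≤ w m)
  heaviest x xs = argmax w x xs , [ (λ e → here e) , there ]′ (argmax-sel w x xs) ,
                  λ { (here refl) → f[⊥]≤f[argmax] {f = w} x xs ; (there q) → All.lookup (f[xs]≤f[argmax] {f = w} x xs) q }

  HeaviestSubset : List A → ℕ → Set
  HeaviestSubset R j = Σ (List A) λ B → (∀ {r} → r ∈ B → r ∈ R) × Unique B × length B ≡ j ×
                         (∀ {r r′} → r ∈ B → r′ ∈ R → r′ ∉ B → w r′ ≤ w r)

  -- Greedily add a heaviest remaining element.
  heaviestSubset : ∀ R → Unique R → ∀ j → j ≤ length R → HeaviestSubset R j
  heaviestSubset R uR zero    _   = [] , (λ ()) , [] , refl , (λ ())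
  heaviestSubset R uR (suc j) j<∣R∣ with heaviestSubset R uR j (≤-trans (n≤1+n j) j<∣R∣)
  ... | B , B⊆R , uB , ∣B∣≡j , heavy with filter (λ r → ¬? (r ∈? B)) R in rest≡
  ...   | [] = ⊥-elim (<-irrefl refl (≤-trans j<∣R∣ (≤-trans (length-mono-⊆ R B uR R⊆B) (≤-reflexive ∣B∣≡j))))
    where
    R⊆B : ∀ {r} → r ∈ R → r ∈ B
    R⊆B {r} r∈R with r ∈? B
    ... | yes r∈B = r∈B
    ... | no  r∉B with subst (r ∈_) rest≡ (∈-filter⁺ (λ r → ¬? (r ∈? B)) r∈R r∉B)
    ...   | ()
  ...   | r₀ ∷ rs with heaviest r₀ rs
  ...     | m , m∈rest , max = m ∷ B , m∷B⊆R , uniq , cong suc ∣B∣≡j , heavy′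
    where
    m∈R×m∉B = ∈-filter⁻ (λ r → ¬? (r ∈? B)) {xs = R} (subst (m ∈_) (sym rest≡) m∈rest)
    m∷B⊆R : ∀ {r} → r ∈ m ∷ B → r ∈ R
    m∷B⊆R (here refl) = proj₁ m∈R×m∉B
    m∷B⊆R (there p)   = B⊆R p
    uniq : Unique (m ∷ B)
    uniq = All.tabulate (λ p e → proj₂ m∈R×m∉B (subst (_∈ B) (sym e) p)) ∷ uB
    heavy′ : ∀ {r r′} → r ∈ m ∷ B → r′ ∈ R → r′ ∉ m ∷ B → w r′ ≤ w r
    heavy′ (here refl) r′∈R r′∉ = max (subst (_ ∈_) rest≡ (∈-filter⁺ (λ r → ¬? (r ∈? B)) r′∈R (λ q → r′∉ (there q))))
    heavy′ (there p)   r′∈R r′∉ = heavy p r′∈R (λ q → r′∉ (there q))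

module _ (d : ℕ) where

  InRange : ℕ → Set
  InRange r = 1 ≤ r × r ≤ d

  ranks : List ℕ
  ranks = applyUpTo suc d

  ∈-ranks⁺ : ∀ {r} → InRange r → r ∈ ranks
  ∈-ranks⁺ {suc r} (_ , r<d) = ∈-applyUpTo⁺ suc r<d

  ∈-ranks⁻ : ∀ {r} → r ∈ ranks → InRange r
  ∈-ranks⁻ p with i , i<d , refl ← ∈-applyUpTo⁻ suc p = s≤s z≤n , i<d

module _ (w : ℕ → ℕ) (d : ℕ) where
  open DecMembership ℕ._≟_ using (_∈?_)

  HeaviestRanks : ℕ → Set
  HeaviestRanks j = Σ (List ℕ) λ rs → length rs ≡ j × Linked _<_ rs × Unique rs × All (InRange d) rs ×
                      (∀ {r r′} → r ∈ rs → InRange d r′ → r′ ∉ rs → w r′ ≤ w r)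

  heaviestRanks : ∀ j → j ≤ d → HeaviestRanks j
  heaviestRanks j j≤d with B , B⊆ranks , uB , ∣B∣≡j , heavy ←
    heaviestSubset ℕ._≟_ w (ranks d) (Unique.applyUpTo⁺₁ suc d (λ i<j _ → <⇒≢ (s≤s i<j))) j
                   (subst (j ≤_) (sym (length-applyUpTo suc d)) j≤d)
    = rs , ∣rs∣≡j , Linked.filter⁺ (_∈? B) <-trans (Linked.applyUpTo⁺₂ suc d (λ i → n<1+n (suc i))) ,
      urs , All.tabulate (λ p → ∈-ranks⁻ d (rs⊆ranks p)) ,
      (λ p r′∈ r′∉ → heavy (rs⊆B p) (∈-ranks⁺ d r′∈) (λ q → r′∉ (B⊆rs q)))
    where
    rs = filter (_∈? B) (ranks d)
    urs : Unique rs
    urs = Unique.filter⁺ (_∈? B) (Unique.applyUpTo⁺₁ suc d (λ i<j _ → <⇒≢ (s≤s i<j)))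
    rs⊆ranks : ∀ {r} → r ∈ rs → r ∈ ranks d
    rs⊆ranks p = proj₁ (∈-filter⁻ (_∈? B) {xs = ranks d} p)
    rs⊆B : ∀ {r} → r ∈ rs → r ∈ B
    rs⊆B p = proj₂ (∈-filter⁻ (_∈? B) {xs = ranks d} p)
    B⊆rs : ∀ {r} → r ∈ B → r ∈ rs
    B⊆rs p = ∈-filter⁺ (_∈? B) (B⊆ranks p) p
    ∣rs∣≡j : length rs ≡ j
    ∣rs∣≡j = trans (≤-antisym (length-mono-⊆ rs B urs rs⊆B) (length-mono-⊆ B rs uB B⊆rs)) ∣B∣≡j

-- Integral flows, LYM and the strong Sperner property

open DecMembership ℕ._≟_ using () renaming (_∈?_ to _∈ℕ?_)

member : ∀ {A : Set} (xs : List A) → 1 ≤ length xs → ∃ (_∈ xs)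
member (x ∷ _) _ = x , here refl

≡0⇒≤ : ∀ {m n} → m ≡ 0 → m ≤ n
≡0⇒≤ refl = z≤n

*-pos : ∀ {m n} → 0 < m → 0 < n → 0 < m * n
*-pos {suc m} {suc n} _ _ = s≤s z≤n

ℕ→ℚ : ℕ → ℚ
ℕ→ℚ zero    = 0ℚ
ℕ→ℚ (suc n) = 1ℚ ℚ.+ ℕ→ℚ n

ℕ→ℚ-+ : ∀ m n → ℕ→ℚ (m + n) ≡ ℕ→ℚ m ℚ.+ ℕ→ℚ n
ℕ→ℚ-+ zero    n = sym (ℚ.+-identityˡ (ℕ→ℚ n))
ℕ→ℚ-+ (suc m) n = trans (cong (1ℚ ℚ.+_) (ℕ→ℚ-+ m n)) (sym (ℚ.+-assoc 1ℚ (ℕ→ℚ m) (ℕ→ℚ n)))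

ℕ→ℚ-∑ : ∀ {A : Set} (xs : List A) (g : A → ℕ) → foldr ℚ._+_ 0ℚ (map (λ x → ℕ→ℚ (g x)) xs) ≡ ℕ→ℚ (∑ xs g)
ℕ→ℚ-∑ []       g = refl
ℕ→ℚ-∑ (x ∷ xs) g = trans (cong (ℕ→ℚ (g x) ℚ.+_) (ℕ→ℚ-∑ xs g)) (sym (ℕ→ℚ-+ (g x) (∑ xs g)))

ℕ→ℚ-nonNeg : ∀ n → 0ℚ ℚ.≤ ℕ→ℚ n
ℕ→ℚ-nonNeg zero    = ℚ.≤-refl
ℕ→ℚ-nonNeg (suc n) = subst (ℚ._≤ ℕ→ℚ (suc n)) (ℚ.+-identityʳ 0ℚ)
                       (ℚ.+-mono-≤ (toWitness {a? = 0ℚ ℚ.≤? 1ℚ} tt) (ℕ→ℚ-nonNeg n))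

ℕ→ℚ-pos : ∀ n → 0 < n → 0ℚ ℚ.< ℕ→ℚ n
ℕ→ℚ-pos (suc n) _ = subst (ℚ._< ℕ→ℚ (suc n)) (ℚ.+-identityʳ 0ℚ)
                      (ℚ.+-mono-<-≤ (toWitness {a? = 0ℚ ℚ.<? 1ℚ} tt) (ℕ→ℚ-nonNeg n))

module _ (P : FinGradedPoset) where
  open FinGradedPoset P hiding (_≤?_) renaming (_≤_ to _⊑_; _≟_ to _≟ᶜ_)

  open DecMembership _≟ᶜ_ using () renaming (_∈?_ to _∈ᶜ?_)

  _⋖ᴾ_ : Carrier → Carrier → Set
  _⋖ᴾ_ = _⋖_ P

  _⋖ᴾ?_ : (x y : Carrier) → Dec (x ⋖ᴾ y)
  _⋖ᴾ?_ = _⋖?_ P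

  record IsRanked : Set where
    field
      rank-bounds : ∀ {x} → x ∈ elems → 1 ≤ rank x × rank x ≤ d
      ⊑-trans     : ∀ {x y z} → x ∈ elems → y ∈ elems → z ∈ elems → x ⊑ y → y ⊑ z → x ⊑ z
      ⋖⇒rank-suc  : ∀ {x y} → x ∈ elems → y ∈ elems → x ⋖ᴾ y → rank y ≡ suc (rank x)

  record IntegralFlow : Set where
    field
      flow     : Carrier → Carrier → ℕ
      up down  : ℕ → ℕ
      up-pos   : ∀ r → r < d → 0 < up r
      down-pos : ∀ r → 1 ≤ r → 0 < down r
      outflow  : ∀ {x} → x ∈ elems → rank x < d → ∑ (filter (x ⋖ᴾ?_) elems) (flow x) ≡ up (rank x)
      inflow   : ∀ {y} r → y ∈ elems → rank y ≡ suc r → 1 ≤ r →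
                 ∑ (filter (_⋖ᴾ? y) elems) (λ x → flow x y) ≡ down r

  integralFlow⇒normalizedFlow : IntegralFlow → HasNormalizedFlow P
  integralFlow⇒normalizedFlow F =
    (λ x y → ℕ→ℚ (flow x y)) , (λ x y _ _ _ → ℕ→ℚ-nonNeg (flow x y)) ,
    λ r 1≤r r<d →
      (ℕ→ℚ (up r) , ℕ→ℚ-pos (up r) (up-pos r r<d) ,
       λ x xE e → trans (ℕ→ℚ-∑ (filter (x ⋖ᴾ?_) elems) (flow x))
                        (cong ℕ→ℚ (trans (outflow xE (subst (_< d) (sym e) r<d)) (cong up e)))) ,
      (ℕ→ℚ (down r) , ℕ→ℚ-pos (down r) (down-pos r 1≤r) ,
       λ y yE e → trans (ℕ→ℚ-∑ (filter (_⋖ᴾ? y) elems) (λ x → flow x y)) (cong ℕ→ℚ (inflow r yE e 1≤r)))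
    where open IntegralFlow F

  module WeightedCount (ranked : IsRanked) (F : IntegralFlow) where
    open IsRanked ranked
    open IntegralFlow F
    open ≤-Reasoning

    Wᴾ : ℕ → ℕ
    Wᴾ = W P

    atRank : ℕ → Carrier → ℕ
    atRank r x = 𝟙 (does (rank x ≟ r))

    Wᴾ≡∑ : ∀ r → Wᴾ r ≡ ∑ elems (atRank r)
    Wᴾ≡∑ r = length-filter (λ x → rank x ≟ r) elems

    downProd : ℕ → ℕ
    downProd zero = 1
    downProd (suc zero) = 1
    downProd (suc (suc r)) = downProd (suc r) * down (suc r)

    downProd-suc : ∀ r → 1 ≤ r → downProd (suc r) ≡ downProd r * down r
    downProd-suc (suc r) _ = refl

    downProd-pos : ∀ r → 0 < downProd r
    downProd-pos zero = s≤s z≤n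
    downProd-pos (suc zero) = s≤s z≤n
    downProd-pos (suc (suc r)) = *-pos (downProd-pos (suc r)) (down-pos (suc r) (s≤s z≤n))

    upProdFrom : ℕ → ℕ → ℕ
    upProdFrom zero r = 1
    upProdFrom (suc m) r = up r * upProdFrom m (suc r)

    upProd : ℕ → ℕ
    upProd r = upProdFrom (d ∸ r) r

    upProd-suc : ∀ r → r < d → upProd r ≡ up r * upProd (suc r)
    upProd-suc r r<d rewrite +-∸-assoc 1 r<d = refl

    upProdFrom-pos : ∀ m r → r + m ≡ d → 0 < upProdFrom m r
    upProdFrom-pos zero r e = s≤s z≤n
    upProdFrom-pos (suc m) r e = *-pos (up-pos r (subst (r <_) e (m<m+n r (s≤s z≤n))))
                                       (upProdFrom-pos m (suc r) (trans (sym (+-suc r m)) e))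

    upProd-pos : ∀ r → r ≤ d → 0 < upProd r
    upProd-pos r r≤d = upProdFrom-pos (d ∸ r) r (m+[n∸m]≡n r≤d)

    -- weight r is proportional to 1 / Wᴾ r (see Wᴾ*weight≡total).
    weight : ℕ → ℕ
    weight r = downProd r * upProd r

    weight-pos : ∀ r → r ≤ d → 0 < weight r
    weight-pos r r≤d = *-pos (downProd-pos r) (upProd-pos r r≤d)

    total : ℕ
    total = Wᴾ 1 * weight 1

    edge : Carrier → Carrier → ℕ
    edge x y = 𝟙 (does (x ⋖ᴾ? y)) * flow x y

    -- The total flow from rank r to rank r + 1, counted below from both ends.
    flowFrom : ℕ → ℕ
    flowFrom r = ∑ elems (λ x → ∑ elems (λ y → atRank r x * edge x y))

    flowFrom≡out : ∀ r → r < d → flowFrom r ≡ Wᴾ r * up r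
    flowFrom≡out r r<d = begin-equality
      ∑ elems (λ x → ∑ elems (λ y → atRank r x * edge x y))
        ≡⟨ ∑-cong elems (λ x xE → trans (∑-*ˡ elems (atRank r x) (edge x)) (out x xE (rank x ≟ r))) ⟩
      ∑ elems (λ x → atRank r x * up r) ≡⟨ ∑-*ʳ elems (up r) (atRank r) ⟩
      ∑ elems (atRank r) * up r         ≡⟨ cong (_* up r) (sym (Wᴾ≡∑ r)) ⟩
      Wᴾ r * up r ∎
      where
      out : ∀ x → x ∈ elems → (b : Dec (rank x ≡ r)) → 𝟙 (does b) * ∑ elems (edge x) ≡ 𝟙 (does b) * up r
      out x xE (no _)     = refl
      out x xE (yes refl) = cong (1 *_) (trans (sym (∑-filter (x ⋖ᴾ?_) elems (flow x))) (outflow xE r<d))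

    flowFrom≡in : ∀ r → 1 ≤ r → flowFrom r ≡ Wᴾ (suc r) * down r
    flowFrom≡in r 1≤r = begin-equality
      ∑ elems (λ x → ∑ elems (λ y → atRank r x * edge x y))
        ≡⟨ ∑-swap elems elems _ ⟩
      ∑ elems (λ y → ∑ elems (λ x → atRank r x * edge x y))
        ≡⟨ ∑-cong elems (λ y yE → trans (∑-cong elems (λ x xE → rank-of-lower y yE x xE (x ⋖ᴾ? y)))
                                        (trans (∑-*ˡ elems (atRank (suc r) y) (λ x → edge x y))
                                               (inn y yE (rank y ≟ suc r)))) ⟩
      ∑ elems (λ y → atRank (suc r) y * down r) ≡⟨ ∑-*ʳ elems (down r) (atRank (suc r)) ⟩
      ∑ elems (atRank (suc r)) * down r         ≡⟨ cong (_* down r) (sym (Wᴾ≡∑ (suc r))) ⟩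
      Wᴾ (suc r) * down r ∎
      where
      rank-of-lower : ∀ y → y ∈ elems → ∀ x → x ∈ elems → (c : Dec (x ⋖ᴾ y)) →
        atRank r x * (𝟙 (does c) * flow x y) ≡ atRank (suc r) y * (𝟙 (does c) * flow x y)
      rank-of-lower y yE x xE (no _) = trans (*-zeroʳ (atRank r x)) (sym (*-zeroʳ (atRank (suc r) y)))
      rank-of-lower y yE x xE (yes x⋖y) = cong (_* (1 * flow x y)) (𝟙-cong (rank x ≟ r) (rank y ≟ suc r)
        (λ e → trans (⋖⇒rank-suc xE yE x⋖y) (cong suc e))
        (λ e → suc-injective (trans (sym (⋖⇒rank-suc xE yE x⋖y)) e)))
      inn : ∀ y → y ∈ elems → (b : Dec (rank y ≡ suc r)) →
            𝟙 (does b) * ∑ elems (λ x → edge x y) ≡ 𝟙 (does b) * down r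
      inn y yE (no _)  = refl
      inn y yE (yes e) = cong (1 *_) (trans (sym (∑-filter (_⋖ᴾ? y) elems (λ x → flow x y))) (inflow r yE e 1≤r))

    Wᴾ*up≡Wᴾ*down : ∀ r → 1 ≤ r → r < d → Wᴾ r * up r ≡ Wᴾ (suc r) * down r
    Wᴾ*up≡Wᴾ*down r 1≤r r<d = trans (sym (flowFrom≡out r r<d)) (flowFrom≡in r 1≤r)

    Wᴾ*weight-suc : ∀ r → 1 ≤ r → r < d → Wᴾ r * weight r ≡ Wᴾ (suc r) * weight (suc r)
    Wᴾ*weight-suc r 1≤r r<d rewrite downProd-suc r 1≤r | upProd-suc r r<d = begin-equality
      Wᴾ r * (downProd r * (up r * upProd (suc r)))   ≡⟨ regroup (Wᴾ r) (downProd r) (up r) (upProd (suc r)) ⟩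
      (Wᴾ r * up r) * (downProd r * upProd (suc r))   ≡⟨ cong (_* (downProd r * upProd (suc r))) (Wᴾ*up≡Wᴾ*down r 1≤r r<d) ⟩
      (Wᴾ (suc r) * down r) * (downProd r * upProd (suc r))
        ≡⟨ sym (regroup (Wᴾ (suc r)) (downProd r) (down r) (upProd (suc r))) ⟩
      Wᴾ (suc r) * (downProd r * (down r * upProd (suc r)))
        ≡⟨ cong (Wᴾ (suc r) *_) (sym (*-assoc (downProd r) (down r) (upProd (suc r)))) ⟩
      Wᴾ (suc r) * (downProd r * down r * upProd (suc r)) ∎
      where
      regroup : ∀ w a b u → w * (a * (b * u)) ≡ (w * b) * (a * u)
      regroup = solve-∀

    Wᴾ*weight≡total : ∀ r → 1 ≤ r → r ≤ d → Wᴾ r * weight r ≡ total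
    Wᴾ*weight≡total (suc zero) _ _ = refl
    Wᴾ*weight≡total (suc (suc r)) _ r<d =
      trans (sym (Wᴾ*weight-suc (suc r) (s≤s z≤n) r<d)) (Wᴾ*weight≡total (suc r) (s≤s z≤n) (≤-trans (n≤1+n _) r<d))

    module _ (A : List Carrier) (uniqueA : Unique A) (A⊆elems : ∀ {a} → a ∈ A → a ∈ elems)
             (antichain : ∀ x y → x ∈ A → y ∈ A → x ⊑ y → x ≡ y) where

      inA? : (x : Carrier) → Dec (x ∈ A)
      inA? x = x ∈ᶜ? A

      -- reach m x is the total flow-weight (product of the flow values) of the
      -- maximal chains from x up to rank d that meet A within m steps; since the
      -- flow out of rank r is up r, all chains above a ∈ A weigh upProd (rank a).
      mutual
        reach : ℕ → Carrier → ℕ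
        reach m x = reach′ m x (inA? x)

        reach′ : ℕ → (x : Carrier) → Dec (x ∈ A) → ℕ
        reach′ m       x (yes _) = upProd (rank x)
        reach′ zero    x (no _)  = 0
        reach′ (suc m) x (no _)  = ∑ (filter (x ⋖ᴾ?_) elems) (λ y → flow x y * reach m y)

      mutual
        reach≤upProd : ∀ m x → x ∈ elems → rank x + m ≡ d → reach m x ≤ upProd (rank x)
        reach≤upProd m x xE e = reach′≤upProd m x (inA? x) xE e

        reach′≤upProd : ∀ m x x∈?A → x ∈ elems → rank x + m ≡ d → reach′ m x x∈?A ≤ upProd (rank x)
        reach′≤upProd m       x (yes _) xE e = ≤-refl
        reach′≤upProd zero    x (no _)  xE e = z≤n
        reach′≤upProd (suc m) x (no _)  xE e = begin
          ∑ (filter (x ⋖ᴾ?_) elems) (λ y → flow x y * reach m y)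
            ≤⟨ ∑-mono-≤ (filter (x ⋖ᴾ?_) elems) (λ y y∈ → *-monoʳ-≤ (flow x y) (bound y y∈)) ⟩
          ∑ (filter (x ⋖ᴾ?_) elems) (λ y → flow x y * upProd (suc (rank x)))
            ≡⟨ ∑-*ʳ (filter (x ⋖ᴾ?_) elems) (upProd (suc (rank x))) (flow x) ⟩
          ∑ (filter (x ⋖ᴾ?_) elems) (flow x) * upProd (suc (rank x))
            ≡⟨ cong (_* upProd (suc (rank x))) (outflow xE r<d) ⟩
          up (rank x) * upProd (suc (rank x)) ≡⟨ sym (upProd-suc (rank x) r<d) ⟩
          upProd (rank x) ∎
          where
          r<d : rank x < d
          r<d = subst (rank x <_) e (m<m+n (rank x) (s≤s z≤n))
          bound : ∀ y → y ∈ filter (x ⋖ᴾ?_) elems → reach m y ≤ upProd (suc (rank x))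
          bound y y∈ with ∈-filter⁻ (x ⋖ᴾ?_) {xs = elems} y∈
          ... | yE , x⋖y = subst (λ r → reach m y ≤ upProd r) (⋖⇒rank-suc xE yE x⋖y)
                  (reach≤upProd m y yE (trans (cong (_+ m) (⋖⇒rank-suc xE yE x⋖y)) (trans (sym (+-suc (rank x) m)) e)))

      -- A being an antichain, no chain starting above one of its elements meets it.
      mutual
        reach-above-A : ∀ m x a → x ∈ elems → a ∈ A → a ⊑ x → rank a < rank x → reach m x ≡ 0
        reach-above-A m x a xE aA a⊑x lt = reach′-above-A m x (inA? x) a xE aA a⊑x lt

        reach′-above-A : ∀ m x x∈?A a → x ∈ elems → a ∈ A → a ⊑ x → rank a < rank x → reach′ m x x∈?A ≡ 0
        reach′-above-A m x (yes xA) a xE aA a⊑x lt = ⊥-elim (<-irrefl (cong rank (antichain a x aA xA a⊑x)) lt)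
        reach′-above-A zero x (no _) a xE aA a⊑x lt = refl
        reach′-above-A (suc m) x (no _) a xE aA a⊑x lt = ∑-zero (filter (x ⋖ᴾ?_) elems) vanish
          where
          vanish : ∀ y → y ∈ filter (x ⋖ᴾ?_) elems → flow x y * reach m y ≡ 0
          vanish y y∈ with ∈-filter⁻ (x ⋖ᴾ?_) {xs = elems} y∈
          ... | yE , x⋖y = trans (cong (flow x y *_) (reach-above-A m y a yE aA (⊑-trans (A⊆elems aA) xE yE a⊑x (proj₁ x⋖y))
                                     (<-trans lt (subst (rank x <_) (sym (⋖⇒rank-suc xE yE x⋖y)) (n<1+n _)))))
                                 (*-zeroʳ (flow x y))

      countA : ℕ → ℕ
      countA s = ∑ A (atRank s)

      layerReach : ℕ → ℕ → ℕ
      layerReach m s = ∑ elems (λ x → atRank s x * reach m x)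

      inA : Carrier → ℕ
      inA x = 𝟙 (does (inA? x))

      countA*upProd≤ : ∀ s → countA s * upProd s ≤ ∑ elems (λ x → atRank s x * (inA x * upProd (rank x)))
      countA*upProd≤ s = begin
        countA s * upProd s                          ≡⟨ sym (∑-*ʳ A (upProd s) (atRank s)) ⟩
        ∑ A (λ a → atRank s a * upProd s)            ≡⟨ ∑-cong A (λ a aA → pointwise a (rank a ≟ s) (inA? a) aA) ⟩
        ∑ A (λ a → atRank s a * (inA a * upProd (rank a))) ≤⟨ ∑-mono-⊆ A elems _ uniqueA A⊆elems ⟩
        ∑ elems (λ x → atRank s x * (inA x * upProd (rank x))) ∎
        where
        pointwise : ∀ a (b : Dec (rank a ≡ s)) (a∈?A : Dec (a ∈ A)) → a ∈ A →
                    𝟙 (does b) * upProd s ≡ 𝟙 (does b) * (𝟙 (does a∈?A) * upProd (rank a))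
        pointwise a (no _)     a∈?A     aA = refl
        pointwise a (yes refl) (yes _)  aA = cong (1 *_) (sym (+-identityʳ _))
        pointwise a (yes _)    (no a∉A) aA = ⊥-elim (a∉A aA)

      reach′-suc : ∀ m x (x∈?A : Dec (x ∈ A)) → reach′ (suc m) x x∈?A ≡
                   𝟙 (does x∈?A) * upProd (rank x) + 𝟙 (not (does x∈?A)) * ∑ (filter (x ⋖ᴾ?_) elems) (λ y → flow x y * reach m y)
      reach′-suc m x (yes _) = sym (trans (+-identityʳ _) (+-identityʳ _))
      reach′-suc m x (no _)  = sym (+-identityʳ _)

      layerReach-top : ∀ m → countA d * upProd d + down d * layerReach m (suc d) ≤ layerReach zero d
      layerReach-top m = begin
        countA d * upProd d + down d * layerReach m (suc d) ≡⟨ cong (λ z → countA d * upProd d + down d * z) nothing-above-d ⟩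
        countA d * upProd d + down d * 0                    ≡⟨ cong (countA d * upProd d +_) (*-zeroʳ (down d)) ⟩
        countA d * upProd d + 0                             ≡⟨ +-identityʳ _ ⟩
        countA d * upProd d                                 ≤⟨ countA*upProd≤ d ⟩
        ∑ elems (λ x → atRank d x * (inA x * upProd (rank x)))
          ≡⟨ ∑-cong elems (λ x _ → cong (atRank d x *_) (sym (reach′-zero x (inA? x)))) ⟩
        layerReach zero d ∎
        where
        nothing-above-d : layerReach m (suc d) ≡ 0
        nothing-above-d = ∑-zero elems (λ x xE → cong (_* reach m x) (𝟙-no (rank x ≟ suc d)
                            (λ e → <-irrefl e (s≤s (proj₂ (rank-bounds xE))))))
        reach′-zero : ∀ x (x∈?A : Dec (x ∈ A)) → reach′ zero x x∈?A ≡ 𝟙 (does x∈?A) * upProd (rank x)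
        reach′-zero x (yes _) = sym (+-identityʳ _)
        reach′-zero x (no _)  = refl

      notInA : Carrier → ℕ
      notInA x = 𝟙 (not (does (inA? x)))

      pushUp : ℕ → Carrier → ℕ
      pushUp m x = ∑ (filter (x ⋖ᴾ?_) elems) (λ y → flow x y * reach m y)

      -- The in-flow down s into y is all available to reach y, since no element
      -- of A lies below y when reach m y ≠ 0.
      down*layerReach≤ : ∀ m s → 1 ≤ s → down s * layerReach m (suc s) ≤ ∑ elems (λ x → atRank s x * (notInA x * pushUp m x))
      down*layerReach≤ m s 1≤s = begin
        down s * layerReach m (suc s) ≡⟨ sym (∑-*ˡ elems (down s) _) ⟩
        ∑ elems (λ y → down s * (atRank (suc s) y * reach m y))
          ≤⟨ ∑-mono-≤ elems (λ y yE → into y yE (rank y ≟ suc s)) ⟩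
        ∑ elems (λ y → ∑ elems (λ x → atRank s x * (notInA x * (𝟙 (does (x ⋖ᴾ? y)) * (flow x y * reach m y)))))
          ≡⟨ sym (∑-swap elems elems _) ⟩
        ∑ elems (λ x → ∑ elems (λ y → atRank s x * (notInA x * (𝟙 (does (x ⋖ᴾ? y)) * (flow x y * reach m y)))))
          ≡⟨ ∑-cong elems (λ x _ → pull-out x) ⟩
        ∑ elems (λ x → atRank s x * (notInA x * pushUp m x)) ∎
        where
        from : ∀ {y} → y ∈ elems → rank y ≡ suc s → reach m y ≢ 0 → ∀ x → x ∈ elems →
               (bx : Dec (rank x ≡ s)) (x∈?A : Dec (x ∈ A)) (x⋖?y : Dec (x ⋖ᴾ y)) →
               𝟙 (does bx) * (𝟙 (not (does x∈?A)) * (𝟙 (does x⋖?y) * (flow x y * reach m y)))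
                 ≡ (𝟙 (does x⋖?y) * flow x y) * reach m y
        from yE ry reach≢0 x xE bx x∈?A (no _) =
          trans (cong (𝟙 (does bx) *_) (*-zeroʳ (𝟙 (not (does x∈?A))))) (*-zeroʳ (𝟙 (does bx)))
        from {y} yE ry reach≢0 x xE (yes _) (no _) (yes x⋖y) = unit (flow x y) (reach m y)
          where
          unit : ∀ a b → 1 * (1 * (1 * (a * b))) ≡ (1 * a) * b
          unit = solve-∀
        from yE ry reach≢0 x xE (no rx≢s) x∈?A (yes x⋖y) =
          ⊥-elim (rx≢s (suc-injective (trans (sym (⋖⇒rank-suc xE yE x⋖y)) ry)))
        from {y} yE ry reach≢0 x xE (yes _) (yes xA) (yes x⋖y) =
          ⊥-elim (reach≢0 (reach-above-A m y x yE xA (proj₁ x⋖y) (subst (rank x <_) (sym (⋖⇒rank-suc xE yE x⋖y)) (n<1+n _))))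
        into : ∀ y → y ∈ elems → (b : Dec (rank y ≡ suc s)) →
               down s * (𝟙 (does b) * reach m y) ≤
               ∑ elems (λ x → atRank s x * (notInA x * (𝟙 (does (x ⋖ᴾ? y)) * (flow x y * reach m y))))
        into y yE (no _) = ≡0⇒≤ (*-zeroʳ (down s))
        into y yE (yes ry) with reach m y ≟ 0
        ... | yes z = ≡0⇒≤ (trans (cong (λ w → down s * (1 * w)) z) (*-zeroʳ (down s)))
        ... | no reach≢0 = ≤-reflexive (sym (begin-equality
          ∑ elems (λ x → atRank s x * (notInA x * (𝟙 (does (x ⋖ᴾ? y)) * (flow x y * reach m y))))
            ≡⟨ ∑-cong elems (λ x xE → from yE ry reach≢0 x xE (rank x ≟ s) (inA? x) (x ⋖ᴾ? y)) ⟩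
          ∑ elems (λ x → edge x y * reach m y) ≡⟨ ∑-*ʳ elems (reach m y) (λ x → edge x y) ⟩
          ∑ elems (λ x → edge x y) * reach m y
            ≡⟨ cong (_* reach m y) (trans (sym (∑-filter (_⋖ᴾ? y) elems (λ x → flow x y))) (inflow s yE ry 1≤s)) ⟩
          down s * reach m y ≡⟨ cong (down s *_) (sym (*-identityˡ (reach m y))) ⟩
          down s * (1 * reach m y) ∎))
        pull-out : ∀ x → ∑ elems (λ y → atRank s x * (notInA x * (𝟙 (does (x ⋖ᴾ? y)) * (flow x y * reach m y))))
                         ≡ atRank s x * (notInA x * pushUp m x)
        pull-out x = trans (∑-*ˡ elems (atRank s x) _)
                       (cong (atRank s x *_) (trans (∑-*ˡ elems (notInA x) _)
                         (cong (notInA x *_) (sym (∑-filter (x ⋖ᴾ?_) elems (λ y → flow x y * reach m y))))))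

      layerReach-suc : ∀ m s → 1 ≤ s → countA s * upProd s + down s * layerReach m (suc s) ≤ layerReach (suc m) s
      layerReach-suc m s 1≤s = begin
        countA s * upProd s + down s * layerReach m (suc s)
          ≤⟨ +-mono-≤ (countA*upProd≤ s) (down*layerReach≤ m s 1≤s) ⟩
        ∑ elems (λ x → atRank s x * (inA x * upProd (rank x))) + ∑ elems (λ x → atRank s x * (notInA x * pushUp m x))
          ≡⟨ sym (∑-+ elems _ _) ⟩
        ∑ elems (λ x → atRank s x * (inA x * upProd (rank x)) + atRank s x * (notInA x * pushUp m x))
          ≡⟨ ∑-cong elems (λ x _ → trans (sym (*-distribˡ-+ (atRank s x) _ _))
                                         (cong (atRank s x *_) (sym (reach′-suc m x (inA? x))))) ⟩
        layerReach (suc m) s ∎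

      layerReach-step : ∀ s → 1 ≤ s → s ≤ d →
                        countA s * upProd s + down s * layerReach (d ∸ suc s) (suc s) ≤ layerReach (d ∸ s) s
      layerReach-step s 1≤s s≤d with m≤n⇒m<n∨m≡n s≤d
      ... | inj₁ s<d = subst (λ m → countA s * upProd s + down s * layerReach (d ∸ suc s) (suc s) ≤ layerReach m s)
                             (sym (+-∸-assoc 1 s<d)) (layerReach-suc (d ∸ suc s) s 1≤s)
      ... | inj₂ refl = subst (λ m → countA d * upProd d + down d * layerReach (d ∸ suc d) (suc d) ≤ layerReach m d)
                              (sym (n∸n≡0 d)) (layerReach-top (d ∸ suc d))

      weightA-from≤ : ∀ m s → s + m ≡ suc d → 1 ≤ s →
                      ∑ A (λ a → 𝟙 (does (s ≤? rank a)) * weight (rank a)) ≤ downProd s * layerReach (d ∸ s) s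
      weightA-from≤ zero s e 1≤s = ≡0⇒≤ (∑-zero A (λ a aA → cong (_* weight (rank a))
          (𝟙-no (s ≤? rank a) (λ s≤r → <-irrefl refl (≤-trans (subst (_≤ rank a) (trans (sym (+-identityʳ s)) e) s≤r)
              (proj₂ (rank-bounds (A⊆elems aA))))))))
      weightA-from≤ (suc m) s e 1≤s = begin
        ∑ A (λ a → 𝟙 (does (s ≤? rank a)) * weight (rank a))
          ≡⟨ ∑-cong A (λ a _ → split (rank a) (s ≤? rank a) (rank a ≟ s) (suc s ≤? rank a)) ⟩
        ∑ A (λ a → atRank s a * weight s + 𝟙 (does (suc s ≤? rank a)) * weight (rank a))
          ≡⟨ ∑-+ A _ _ ⟩
        ∑ A (λ a → atRank s a * weight s) + ∑ A (λ a → 𝟙 (does (suc s ≤? rank a)) * weight (rank a))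
          ≡⟨ cong (_+ ∑ A (λ a → 𝟙 (does (suc s ≤? rank a)) * weight (rank a))) (∑-*ʳ A (weight s) _) ⟩
        countA s * weight s + ∑ A (λ a → 𝟙 (does (suc s ≤? rank a)) * weight (rank a))
          ≤⟨ +-monoʳ-≤ (countA s * weight s) (weightA-from≤ m (suc s) (trans (sym (+-suc s m)) e) (s≤s z≤n)) ⟩
        countA s * weight s + downProd (suc s) * layerReach (d ∸ suc s) (suc s)
          ≡⟨ cong (λ z → countA s * weight s + z * layerReach (d ∸ suc s) (suc s)) (downProd-suc s 1≤s) ⟩
        countA s * (downProd s * upProd s) + (downProd s * down s) * layerReach (d ∸ suc s) (suc s)
          ≡⟨ sym (factor (downProd s) (countA s) (upProd s) (down s) _) ⟩
        downProd s * (countA s * upProd s + down s * layerReach (d ∸ suc s) (suc s))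
          ≤⟨ *-monoʳ-≤ (downProd s) (layerReach-step s 1≤s s≤d) ⟩
        downProd s * layerReach (d ∸ s) s ∎
        where
        s≤d : s ≤ d
        s≤d = ≤-pred (subst (s <_) e (m<m+n s (s≤s z≤n)))
        factor : ∀ p c u q l → p * (c * u + q * l) ≡ c * (p * u) + (p * q) * l
        factor = solve-∀
        split : ∀ r (b₁ : Dec (s ≤ r)) (b₂ : Dec (r ≡ s)) (b₃ : Dec (suc s ≤ r)) →
                𝟙 (does b₁) * weight r ≡ 𝟙 (does b₂) * weight s + 𝟙 (does b₃) * weight r
        split r (yes _)  (yes refl) (no _)  = sym (+-identityʳ _)
        split r _        (yes refl) (yes p) = ⊥-elim (<-irrefl refl p)
        split r (no s≰r) (yes refl) _       = ⊥-elim (s≰r ≤-refl)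
        split r (yes _)  (no _)     (yes _) = refl
        split r (no _)   (no _)     (no _)  = refl
        split r (yes p)  (no r≢s)   (no ¬q) = ⊥-elim (¬q (≤∧≢⇒< p (λ e → r≢s (sym e))))
        split r (no s≰r) (no _)     (yes p) = ⊥-elim (s≰r (≤-trans (n≤1+n s) p))

      lym : ∑ A (λ a → weight (rank a)) ≤ total
      lym = begin
        ∑ A (λ a → weight (rank a))
          ≡⟨ ∑-cong A (λ a aA → sym (trans (cong (_* weight (rank a)) (𝟙-yes (1 ≤? rank a) (proj₁ (rank-bounds (A⊆elems aA)))))
                                              (+-identityʳ _))) ⟩
        ∑ A (λ a → 𝟙 (does (1 ≤? rank a)) * weight (rank a)) ≤⟨ weightA-from≤ d 1 refl (s≤s z≤n) ⟩
        downProd 1 * layerReach (d ∸ 1) 1                       ≡⟨ +-identityʳ _ ⟩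
        layerReach (d ∸ 1) 1                                     ≤⟨ ∑-mono-≤ elems (λ x xE → bottom x xE (rank x ≟ 1)) ⟩
        ∑ elems (λ x → atRank 1 x * upProd 1)                    ≡⟨ ∑-*ʳ elems (upProd 1) (atRank 1) ⟩
        ∑ elems (atRank 1) * upProd 1                            ≡⟨ cong (_* upProd 1) (sym (Wᴾ≡∑ 1)) ⟩
        Wᴾ 1 * upProd 1                                          ≡⟨ cong (Wᴾ 1 *_) (sym (+-identityʳ (upProd 1))) ⟩
        total ∎
        where
        bottom : ∀ x → x ∈ elems → (b : Dec (rank x ≡ 1)) → 𝟙 (does b) * reach (d ∸ 1) x ≤ 𝟙 (does b) * upProd 1
        bottom x xE (no _)     = z≤n
        bottom x xE (yes r≡1) = *-monoʳ-≤ 1 (subst (λ r → reach (d ∸ 1) x ≤ upProd r) r≡1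
          (reach≤upProd (d ∸ 1) x xE (trans (cong (_+ (d ∸ 1)) r≡1) (m+[n∸m]≡n (≤-trans (proj₁ (rank-bounds xE)) (proj₂ (rank-bounds xE)))))))

    dedup : List Carrier → List Carrier
    dedup = deduplicate _≟ᶜ_

    lym-antichain : ∀ A → IsAntichain P A → ∑ (dedup A) (λ a → weight (rank a)) ≤ total
    lym-antichain A (A⊆elems , antichain) = lym (dedup A) (UniqueDec.deduplicate-! _≟ᶜ_ A)
      (λ p → All.lookup A⊆elems (∈-deduplicate⁻ _≟ᶜ_ A p))
      (λ x y px py → antichain x y (∈-deduplicate⁻ _≟ᶜ_ A px) (∈-deduplicate⁻ _≟ᶜ_ A py))

    ∈-union⁻ : ∀ As {x} → x ∈ dedup (concat As) → ∃ λ A → x ∈ A × A ∈ As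
    ∈-union⁻ As p = ∈-concat⁻′ As (∈-deduplicate⁻ _≟ᶜ_ (concat As) p)

    weight-union≤ : ∀ As → All (IsAntichain P) As → ∑ (dedup (concat As)) (λ x → weight (rank x)) ≤ length As * total
    weight-union≤ As antichains = ≤-trans (∑-mono-⊆ _ _ _ (UniqueDec.deduplicate-! _≟ᶜ_ (concat As)) ⊆concat-dedup) (go As antichains)
      where
      ⊆concat-dedup : ∀ {x} → x ∈ dedup (concat As) → x ∈ concat (map dedup As)
      ⊆concat-dedup p with ∈-union⁻ As p
      ... | A , x∈A , A∈As = ∈-concat⁺′ (∈-deduplicate⁺ _≟ᶜ_ x∈A) (∈-map⁺ dedup A∈As)
      go : ∀ As → All (IsAntichain P) As → ∑ (concat (map dedup As)) (λ x → weight (rank x)) ≤ length As * total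
      go []       _              = z≤n
      go (A ∷ As) (anti ∷ antis) = begin
        ∑ (dedup A ++ concat (map dedup As)) (λ x → weight (rank x)) ≡⟨ ∑-++ (dedup A) _ _ ⟩
        ∑ (dedup A) (λ x → weight (rank x)) + ∑ (concat (map dedup As)) (λ x → weight (rank x))
          ≤⟨ +-mono-≤ (lym-antichain A anti) (go As antis) ⟩
        total + length As * total ∎

    ∑-byRank : ∀ rs → Unique rs → ∀ (h : ℕ → ℕ) → ∑ elems (λ x → 𝟙 (does (rank x ∈ℕ? rs)) * h (rank x)) ≡ ∑ rs (λ r → Wᴾ r * h r)
    ∑-byRank []       _           h = ∑-zero elems (λ x _ → cong (_* h (rank x)) (𝟙-no (rank x ∈ℕ? []) (λ ())))
    ∑-byRank (r ∷ rs) (r∉rs ∷ urs) h = begin-equality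
      ∑ elems (λ x → 𝟙 (does (rank x ∈ℕ? (r ∷ rs))) * h (rank x))
        ≡⟨ ∑-cong elems (λ x _ → split (rank x) (rank x ∈ℕ? (r ∷ rs)) (rank x ≟ r) (rank x ∈ℕ? rs)) ⟩
      ∑ elems (λ x → atRank r x * h r + 𝟙 (does (rank x ∈ℕ? rs)) * h (rank x))
        ≡⟨ ∑-+ elems _ _ ⟩
      ∑ elems (λ x → atRank r x * h r) + ∑ elems (λ x → 𝟙 (does (rank x ∈ℕ? rs)) * h (rank x))
        ≡⟨ cong₂ _+_ (trans (∑-*ʳ elems (h r) _) (cong (_* h r) (sym (Wᴾ≡∑ r)))) (∑-byRank rs urs h) ⟩
      Wᴾ r * h r + ∑ rs (λ r → Wᴾ r * h r) ∎
      where
      split : ∀ y (b₀ : Dec (y ∈ r ∷ rs)) (b₁ : Dec (y ≡ r)) (b₂ : Dec (y ∈ rs)) →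
              𝟙 (does b₀) * h y ≡ 𝟙 (does b₁) * h r + 𝟙 (does b₂) * h y
      split y _               (yes refl) (yes p)  = ⊥-elim (All.lookup r∉rs p refl)
      split y (yes _)         (yes refl) (no _)   = sym (+-identityʳ _)
      split y (no y∉)         (yes refl) (no _)   = ⊥-elim (y∉ (here refl))
      split y (yes _)         (no _)     (yes _)  = refl
      split y (no y∉)         (no _)     (yes p)  = ⊥-elim (y∉ (there p))
      split y (no _)          (no _)     (no _)   = refl
      split y (yes (here e))  (no y≢r)   (no _)   = ⊥-elim (y≢r e)
      split y (yes (there p)) (no _)     (no y∉)  = ⊥-elim (y∉ p)

    weight-antitone : ∀ r r′ → 1 ≤ r → r ≤ d → 1 ≤ r′ → r′ ≤ d → Wᴾ r′ ≤ Wᴾ r → 0 < Wᴾ r′ → weight r ≤ weight r′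
    weight-antitone r r′ 1≤r r≤d 1≤r′ r′≤d W≤W 0<W = *-cancelˡ-≤ (Wᴾ r′) {{ℕ.>-nonZero 0<W}} (begin
      Wᴾ r′ * weight r ≤⟨ *-monoˡ-≤ (weight r) W≤W ⟩
      Wᴾ r * weight r  ≡⟨ Wᴾ*weight≡total r 1≤r r≤d ⟩
      total            ≡⟨ sym (Wᴾ*weight≡total r′ 1≤r′ r′≤d) ⟩
      Wᴾ r′ * weight r′ ∎)

    Wᴾ-pos : ∀ {x} → x ∈ elems → 0 < Wᴾ (rank x)
    Wᴾ-pos {x} xE = begin-strict
      0                   <⟨ s≤s z≤n ⟩
      1                   ≡⟨ sym (𝟙-yes (rank x ≟ rank x) refl) ⟩
      atRank (rank x) x   ≤⟨ term≤∑ elems (atRank (rank x)) xE ⟩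
      ∑ elems (atRank (rank x)) ≡⟨ sym (Wᴾ≡∑ (rank x)) ⟩
      Wᴾ (rank x) ∎

    -- With t the largest weight among the ranks rs, every x in the union
    -- contributes t ≤ [rank x ∈ rs] (t ∸ weight) + weight; summing and using
    -- LYM for each antichain gives t · |⋃ As| ≤ t · ∑ rs Wᴾ.
    union≤∑Wᴾ : ∀ rs → Unique rs → 1 ≤ length rs → (∀ {r} → r ∈ rs → InRange d r) →
                (∀ {r r′} → r ∈ rs → InRange d r′ → r′ ∉ rs → Wᴾ r′ ≤ Wᴾ r) →
                ∀ As → length As ≡ length rs → All (IsAntichain P) As → unionSize P As ≤ ∑ rs Wᴾ
    union≤∑Wᴾ rs urs nonempty rs-range heavy As ∣As∣≡ antichains =
      *-cancelˡ-≤ t {{ℕ.>-nonZero 0<t}} (begin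
        t * length U                                               ≡⟨ trans (*-comm t _) (sym (∑-const U t)) ⟩
        ∑ U (λ _ → t)                                              ≤⟨ ∑-mono-≤ U (λ x x∈U → t≤ x x∈U (rank x ∈ℕ? rs)) ⟩
        ∑ U (λ x → chosen x * (t ∸ weight (rank x)) + weight (rank x)) ≡⟨ ∑-+ U _ _ ⟩
        ∑ U (λ x → chosen x * (t ∸ weight (rank x))) + ∑ U (λ x → weight (rank x))
          ≤⟨ +-mono-≤ (∑-mono-⊆ U elems _ (UniqueDec.deduplicate-! _≟ᶜ_ (concat As)) U⊆elems) (weight-union≤ As antichains) ⟩
        ∑ elems (λ x → chosen x * (t ∸ weight (rank x))) + length As * total
          ≡⟨ cong₂ _+_ (∑-byRank rs urs (λ r → t ∸ weight r)) (trans (cong (_* total) ∣As∣≡) (sym ∑Wᴾ*weight)) ⟩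
        ∑ rs (λ r → Wᴾ r * (t ∸ weight r)) + ∑ rs (λ r → Wᴾ r * weight r) ≡⟨ sym (∑-+ rs _ _) ⟩
        ∑ rs (λ r → Wᴾ r * (t ∸ weight r) + Wᴾ r * weight r)
          ≡⟨ ∑-cong rs (λ r p → trans (sym (*-distribˡ-+ (Wᴾ r) _ _)) (cong (Wᴾ r *_) (m∸n+n≡m (weight≤t p)))) ⟩
        ∑ rs (λ r → Wᴾ r * t)                                       ≡⟨ trans (∑-*ʳ rs t Wᴾ) (*-comm _ t) ⟩
        t * ∑ rs Wᴾ ∎)
      where
      U = dedup (concat As)
      t = max 0 (map weight rs)
      chosen : Carrier → ℕ
      chosen x = 𝟙 (does (rank x ∈ℕ? rs))
      weight≤t : ∀ {r} → r ∈ rs → weight r ≤ t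
      weight≤t p = All.lookup (xs≤max 0 (map weight rs)) (∈-map⁺ weight p)
      0<t : 0 < t
      0<t with r , r∈rs ← member rs nonempty = ≤-trans (weight-pos r (proj₂ (rs-range r∈rs))) (weight≤t r∈rs)
      U⊆elems : ∀ {x} → x ∈ U → x ∈ elems
      U⊆elems p with ∈-union⁻ As p
      ... | A , x∈A , A∈As = All.lookup (proj₁ (All.lookup antichains A∈As)) x∈A
      t≤ : ∀ x → x ∈ U → (b : Dec (rank x ∈ rs)) → t ≤ 𝟙 (does b) * (t ∸ weight (rank x)) + weight (rank x)
      t≤ x x∈U (yes p) = ≤-reflexive (sym (trans (cong (_+ weight (rank x)) (+-identityʳ _)) (m∸n+n≡m (weight≤t p))))
      t≤ x x∈U (no ¬p) = max≤v⁺ z≤n (All.map⁺ (All.tabulate (λ {r} p →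
          weight-antitone r (rank x) (proj₁ (rs-range p)) (proj₂ (rs-range p)) (proj₁ x-range) (proj₂ x-range)
            (heavy p x-range ¬p) (Wᴾ-pos xE))))
        where
        xE = U⊆elems x∈U
        x-range = rank-bounds xE
      ∑Wᴾ*weight : ∑ rs (λ r → Wᴾ r * weight r) ≡ length rs * total
      ∑Wᴾ*weight = trans (∑-cong rs (λ r p → Wᴾ*weight≡total r (proj₁ (rs-range p)) (proj₂ (rs-range p)))) (∑-const rs total)

    stronglySperner : StronglySperner P
    stronglySperner j 1≤j j≤d As ∣As∣≡j antichains
      with rs , ∣rs∣≡j , sorted , urs , rs-range , heavy ← heaviestRanks Wᴾ d j j≤d
      = rs , ∣rs∣≡j , sorted , rs-range ,
        union≤∑Wᴾ rs urs (subst (1 ≤_) (sym ∣rs∣≡j) 1≤j) (All.lookup rs-range) heavy As (trans ∣As∣≡j (sym ∣rs∣≡j)) antichains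

normalizedFlow×stronglySperner : ∀ {P} → IsRanked P → IntegralFlow P → HasNormalizedFlow P × StronglySperner P
normalizedFlow×stronglySperner ranked F = integralFlow⇒normalizedFlow _ F , WeightedCount.stronglySperner _ ranked F

-- Sign vectors

does-≡ : ∀ {p} {P : Set p} (d : Dec P) (b : Bool) → (P → b ≡ true) → (b ≡ true → P) → does d ≡ b
does-≡ (yes p) true f g = refl
does-≡ (yes p) false f g = sym (f p)
does-≡ (no ¬p) true f g = ⊥-elim (¬p (g refl))
does-≡ (no ¬p) false f g = refl

∧≡true⁻ : ∀ {a b} → a ∧ b ≡ true → a ≡ true × b ≡ true
∧≡true⁻ {true} {true} _ = refl , refl


negˢ-involutive : ∀ a → negˢ (negˢ a) ≡ a
negˢ-involutive 𝟎 = refl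
negˢ-involutive ⊕ = refl
negˢ-involutive ⊖ = refl

negᵛ : ∀ {n} → Vec Sign n → Vec Sign n
negᵛ = V.map negˢ

negᵛ-involutive : ∀ {n} (v : Vec Sign n) → negᵛ (negᵛ v) ≡ v
negᵛ-involutive [] = refl
negᵛ-involutive (a ∷ v) = cong₂ _∷_ (negˢ-involutive a) (negᵛ-involutive v)

rankᵛ : ∀ {n} → Vec Sign n → ℕ
rankᵛ v = length (nonzeros v)

nonzeros-negᵛ : ∀ {n} (v : Vec Sign n) → nonzeros (negᵛ v) ≡ map negˢ (nonzeros v)
nonzeros-negᵛ [] = refl
nonzeros-negᵛ (𝟎 ∷ v) = nonzeros-negᵛ v
nonzeros-negᵛ (⊕ ∷ v) = cong (⊖ ∷_) (nonzeros-negᵛ v)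
nonzeros-negᵛ (⊖ ∷ v) = cong (⊕ ∷_) (nonzeros-negᵛ v)

rankᵛ-negᵛ : ∀ {n} (v : Vec Sign n) → rankᵛ (negᵛ v) ≡ rankᵛ v
rankᵛ-negᵛ v = trans (cong length (nonzeros-negᵛ v)) (length-map negˢ (nonzeros v))

rankᵛ≤n : ∀ {n} (v : Vec Sign n) → rankᵛ v ≤ n
rankᵛ≤n [] = z≤n
rankᵛ≤n (𝟎 ∷ v) = ≤-trans (rankᵛ≤n v) (n≤1+n _)
rankᵛ≤n (⊕ ∷ v) = s≤s (rankᵛ≤n v)
rankᵛ≤n (⊖ ∷ v) = s≤s (rankᵛ≤n v)

AllNonzero : List Sign → Set
AllNonzero = All (λ s → s ≢ 𝟎)

nonzeros-allNonzero : ∀ {n} (v : Vec Sign n) → AllNonzero (nonzeros v)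
nonzeros-allNonzero [] = []
nonzeros-allNonzero (𝟎 ∷ v) = nonzeros-allNonzero v
nonzeros-allNonzero (⊕ ∷ v) = (λ ()) ∷ nonzeros-allNonzero v
nonzeros-allNonzero (⊖ ∷ v) = (λ ()) ∷ nonzeros-allNonzero v

change : Sign → Sign → ℕ
change a b = 𝟙 (not (does (a ≟ˢ b)))

changesFrom-∷ : ∀ a b xs → changesFrom a (b ∷ xs) ≡ change a b + changesFrom b xs
changesFrom-∷ a b xs with a ≟ˢ b
... | yes _ = refl
... | no  _ = refl

change-negˢ : ∀ a b → change (negˢ a) (negˢ b) ≡ change a b
change-negˢ 𝟎 𝟎 = refl
change-negˢ 𝟎 ⊕ = refl
change-negˢ 𝟎 ⊖ = refl
change-negˢ ⊕ 𝟎 = refl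
change-negˢ ⊕ ⊕ = refl
change-negˢ ⊕ ⊖ = refl
change-negˢ ⊖ 𝟎 = refl
change-negˢ ⊖ ⊕ = refl
change-negˢ ⊖ ⊖ = refl

changesFrom-negˢ : ∀ a xs → changesFrom (negˢ a) (map negˢ xs) ≡ changesFrom a xs
changesFrom-negˢ a []       = refl
changesFrom-negˢ a (b ∷ xs) = trans (changesFrom-∷ (negˢ a) (negˢ b) (map negˢ xs))
  (trans (cong₂ _+_ (change-negˢ a b) (changesFrom-negˢ b xs)) (sym (changesFrom-∷ a b xs)))

changes-negˢ : ∀ xs → changes (map negˢ xs) ≡ changes xs
changes-negˢ []       = refl
changes-negˢ (a ∷ xs) = changesFrom-negˢ a xs

signChanges-negᵛ : ∀ {n} (v : Vec Sign n) → signChanges (negᵛ v) ≡ signChanges v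
signChanges-negᵛ v = trans (cong changes (nonzeros-negᵛ v)) (changes-negˢ (nonzeros v))

change-triangle : ∀ a b c → change a c ≤ change a b + change b c
change-triangle a b c with a ≟ˢ b
... | yes refl = ≤-refl
... | no  _    = ≤-trans (𝟙≤1 _) (m≤m+n 1 _)

changesFrom-skip : ∀ a b xs → changesFrom a xs ≤ change a b + changesFrom b xs
changesFrom-skip a b []       = z≤n
changesFrom-skip a b (c ∷ xs) rewrite changesFrom-∷ a c xs | changesFrom-∷ b c xs =
  ≤-trans (+-monoˡ-≤ (changesFrom c xs) (change-triangle a b c)) (≤-reflexive (+-assoc (change a b) (change b c) (changesFrom c xs)))

changes≤changesFrom : ∀ a xs → changes xs ≤ changesFrom a xs
changes≤changesFrom a []       = z≤n
changes≤changesFrom a (b ∷ xs) rewrite changesFrom-∷ a b xs = m≤n+m (changesFrom b xs) (change a b)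

changesFrom-mono-⊆ : ∀ a {xs ys} → xs ⊆ ys → changesFrom a xs ≤ changesFrom a ys
changesFrom-mono-⊆ a []                        = z≤n
changesFrom-mono-⊆ a (_∷ʳ_ {xs} {ys} b xs⊆ys) rewrite changesFrom-∷ a b ys =
  ≤-trans (changesFrom-skip a b xs) (+-monoʳ-≤ (change a b) (changesFrom-mono-⊆ b xs⊆ys))
changesFrom-mono-⊆ a (_∷_ {b} {xs} {_} {ys} refl xs⊆ys) rewrite changesFrom-∷ a b xs | changesFrom-∷ a b ys =
  +-monoʳ-≤ (change a b) (changesFrom-mono-⊆ b xs⊆ys)

changes-mono-⊆ : ∀ {xs ys} → xs ⊆ ys → changes xs ≤ changes ys
changes-mono-⊆ []                        = z≤n
changes-mono-⊆ (_∷ʳ_ {ys = ys} b xs⊆ys) = ≤-trans (changes-mono-⊆ xs⊆ys) (changes≤changesFrom b ys)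
changes-mono-⊆ (_∷_ {b} refl xs⊆ys)     = changesFrom-mono-⊆ b xs⊆ys

changes≤length∸1 : ∀ L → changes L ≤ length L ∸ 1
changes≤length∸1 [] = z≤n
changes≤length∸1 (a ∷ L) = changesFrom≤length a L
  where
  changesFrom≤length : ∀ a L → changesFrom a L ≤ length L
  changesFrom≤length a []      = z≤n
  changesFrom≤length a (b ∷ L) rewrite changesFrom-∷ a b L =
    ≤-trans (+-monoˡ-≤ (changesFrom b L) (𝟙≤1 _)) (s≤s (changesFrom≤length b L))


-- A Boolean form of the order of Defs (restricts x y: x agrees with y off its
-- zeros), so that its indicator can be summed over all sign vectors.
restrictsˢ : Sign → Sign → Bool
restrictsˢ 𝟎 𝟎 = true
restrictsˢ 𝟎 ⊕ = true
restrictsˢ 𝟎 ⊖ = true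
restrictsˢ ⊕ 𝟎 = false
restrictsˢ ⊕ ⊕ = true
restrictsˢ ⊕ ⊖ = false
restrictsˢ ⊖ 𝟎 = false
restrictsˢ ⊖ ⊕ = false
restrictsˢ ⊖ ⊖ = true

restricts : ∀ {n} → Vec Sign n → Vec Sign n → Bool
restricts [] [] = true
restricts (a ∷ x) (b ∷ y) = restrictsˢ a b ∧ restricts x y

restricts-refl : ∀ {n} (x : Vec Sign n) → restricts x x ≡ true
restricts-refl [] = refl
restricts-refl (𝟎 ∷ x) = restricts-refl x
restricts-refl (⊕ ∷ x) = restricts-refl x
restricts-refl (⊖ ∷ x) = restricts-refl x

restrictsˢ-trans : ∀ a b c → restrictsˢ a b ≡ true → restrictsˢ b c ≡ true → restrictsˢ a c ≡ true
restrictsˢ-trans 𝟎 b 𝟎 _ _ = refl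
restrictsˢ-trans 𝟎 b ⊕ _ _ = refl
restrictsˢ-trans 𝟎 b ⊖ _ _ = refl
restrictsˢ-trans ⊕ ⊕ ⊕ _ _ = refl
restrictsˢ-trans ⊖ ⊖ ⊖ _ _ = refl

restricts-trans : ∀ {n} (x y z : Vec Sign n) → restricts x y ≡ true → restricts y z ≡ true → restricts x z ≡ true
restricts-trans [] [] [] _ _ = refl
restricts-trans (a ∷ x) (b ∷ y) (c ∷ z) p q with ∧≡true⁻ {restrictsˢ a b} p | ∧≡true⁻ {restrictsˢ b c} q
... | p1 , p2 | q1 , q2 rewrite restrictsˢ-trans a b c p1 q1 = restricts-trans x y z p2 q2

restrictsˢ-negˢ : ∀ a b → restrictsˢ (negˢ a) (negˢ b) ≡ restrictsˢ a b
restrictsˢ-negˢ 𝟎 𝟎 = refl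
restrictsˢ-negˢ 𝟎 ⊕ = refl
restrictsˢ-negˢ 𝟎 ⊖ = refl
restrictsˢ-negˢ ⊕ 𝟎 = refl
restrictsˢ-negˢ ⊕ ⊕ = refl
restrictsˢ-negˢ ⊕ ⊖ = refl
restrictsˢ-negˢ ⊖ 𝟎 = refl
restrictsˢ-negˢ ⊖ ⊕ = refl
restrictsˢ-negˢ ⊖ ⊖ = refl

restricts-negᵛ : ∀ {n} (x y : Vec Sign n) → restricts (negᵛ x) (negᵛ y) ≡ restricts x y
restricts-negᵛ [] [] = refl
restricts-negᵛ (a ∷ x) (b ∷ y) = cong₂ _∧_ (restrictsˢ-negˢ a b) (restricts-negᵛ x y)

restricts⇒nonzeros-⊆ : ∀ {n} (x y : Vec Sign n) → restricts x y ≡ true → nonzeros x ⊆ nonzeros y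
restricts⇒nonzeros-⊆ [] [] _ = []
restricts⇒nonzeros-⊆ (𝟎 ∷ x) (𝟎 ∷ y) p = restricts⇒nonzeros-⊆ x y p
restricts⇒nonzeros-⊆ (𝟎 ∷ x) (⊕ ∷ y) p = ⊕ ∷ʳ restricts⇒nonzeros-⊆ x y p
restricts⇒nonzeros-⊆ (𝟎 ∷ x) (⊖ ∷ y) p = ⊖ ∷ʳ restricts⇒nonzeros-⊆ x y p
restricts⇒nonzeros-⊆ (⊕ ∷ x) (⊕ ∷ y) p = refl ∷ restricts⇒nonzeros-⊆ x y p
restricts⇒nonzeros-⊆ (⊖ ∷ x) (⊖ ∷ y) p = refl ∷ restricts⇒nonzeros-⊆ x y p
restricts⇒nonzeros-⊆ (⊕ ∷ x) (𝟎 ∷ y) ()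
restricts⇒nonzeros-⊆ (⊕ ∷ x) (⊖ ∷ y) ()
restricts⇒nonzeros-⊆ (⊖ ∷ x) (𝟎 ∷ y) ()
restricts⇒nonzeros-⊆ (⊖ ∷ x) (⊕ ∷ y) ()

restricts⇒rankᵛ-≤ : ∀ {n} (x y : Vec Sign n) → restricts x y ≡ true → rankᵛ x ≤ rankᵛ y
restricts⇒rankᵛ-≤ x y p = length-mono-≤ (restricts⇒nonzeros-⊆ x y p)

restricts⇒signChanges-≤ : ∀ {n} (x y : Vec Sign n) → restricts x y ≡ true → signChanges x ≤ signChanges y
restricts⇒signChanges-≤ x y p = changes-mono-⊆ (restricts⇒nonzeros-⊆ x y p)

restricts-rankᵛ-≡⇒≡ : ∀ {n} (x y : Vec Sign n) → restricts x y ≡ true → rankᵛ x ≡ rankᵛ y → x ≡ y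
restricts-rankᵛ-≡⇒≡ [] [] _ _ = refl
restricts-rankᵛ-≡⇒≡ (𝟎 ∷ x) (𝟎 ∷ y) p e = cong (𝟎 ∷_) (restricts-rankᵛ-≡⇒≡ x y p e)
restricts-rankᵛ-≡⇒≡ (𝟎 ∷ x) (⊕ ∷ y) p e = ⊥-elim (<-irrefl e (s≤s (restricts⇒rankᵛ-≤ x y p)))
restricts-rankᵛ-≡⇒≡ (𝟎 ∷ x) (⊖ ∷ y) p e = ⊥-elim (<-irrefl e (s≤s (restricts⇒rankᵛ-≤ x y p)))
restricts-rankᵛ-≡⇒≡ (⊕ ∷ x) (⊕ ∷ y) p e = cong (⊕ ∷_) (restricts-rankᵛ-≡⇒≡ x y p (suc-injective e))
restricts-rankᵛ-≡⇒≡ (⊖ ∷ x) (⊖ ∷ y) p e = cong (⊖ ∷_) (restricts-rankᵛ-≡⇒≡ x y p (suc-injective e))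
restricts-rankᵛ-≡⇒≡ (⊕ ∷ x) (𝟎 ∷ y) () e
restricts-rankᵛ-≡⇒≡ (⊕ ∷ x) (⊖ ∷ y) () e
restricts-rankᵛ-≡⇒≡ (⊖ ∷ x) (𝟎 ∷ y) () e
restricts-rankᵛ-≡⇒≡ (⊖ ∷ x) (⊕ ∷ y) () e

restricts-interpolate : ∀ {n} (x y : Vec Sign n) → restricts x y ≡ true → rankᵛ x < rankᵛ y →
        Σ (Vec Sign n) λ z → restricts x z ≡ true × restricts z y ≡ true × suc (rankᵛ z) ≡ rankᵛ y
restricts-interpolate (𝟎 ∷ x) (𝟎 ∷ y) p lt with restricts-interpolate x y p lt
... | z , a , b , e = 𝟎 ∷ z , a , b , e
restricts-interpolate (𝟎 ∷ x) (⊕ ∷ y) p lt = 𝟎 ∷ y , p , restricts-refl y , refl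
restricts-interpolate (𝟎 ∷ x) (⊖ ∷ y) p lt = 𝟎 ∷ y , p , restricts-refl y , refl
restricts-interpolate (⊕ ∷ x) (⊕ ∷ y) p (s≤s lt) with restricts-interpolate x y p lt
... | z , a , b , e = ⊕ ∷ z , a , b , cong suc e
restricts-interpolate (⊖ ∷ x) (⊖ ∷ y) p (s≤s lt) with restricts-interpolate x y p lt
... | z , a , b , e = ⊖ ∷ z , a , b , cong suc e
restricts-interpolate (⊕ ∷ x) (𝟎 ∷ y) () lt
restricts-interpolate (⊕ ∷ x) (⊖ ∷ y) () lt
restricts-interpolate (⊖ ∷ x) (𝟎 ∷ y) () lt
restricts-interpolate (⊖ ∷ x) (⊕ ∷ y) () lt

Restrictsˢ : Sign → Sign → Set
Restrictsˢ a b = a ≡ 𝟎 ⊎ a ≡ b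

RestrictsNegˢ : Sign → Sign → Set
RestrictsNegˢ a b = a ≡ 𝟎 ⊎ a ≡ negˢ b

Restrictsˢ⇒restrictsˢ : ∀ a b → Restrictsˢ a b → restrictsˢ a b ≡ true
Restrictsˢ⇒restrictsˢ 𝟎 b (inj₁ refl) with b
... | 𝟎 = refl
... | ⊕ = refl
... | ⊖ = refl
Restrictsˢ⇒restrictsˢ 𝟎 .𝟎 (inj₂ refl) = refl
Restrictsˢ⇒restrictsˢ ⊕ .⊕ (inj₂ refl) = refl
Restrictsˢ⇒restrictsˢ ⊖ .⊖ (inj₂ refl) = refl

restrictsˢ⇒Restrictsˢ : ∀ a b → restrictsˢ a b ≡ true → Restrictsˢ a b
restrictsˢ⇒Restrictsˢ 𝟎 b _ = inj₁ refl
restrictsˢ⇒Restrictsˢ ⊕ ⊕ _ = inj₂ refl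
restrictsˢ⇒Restrictsˢ ⊖ ⊖ _ = inj₂ refl

Pointwise⇒restricts : ∀ {n} (x y : Vec Sign n) → Pointwise Restrictsˢ x y → restricts x y ≡ true
Pointwise⇒restricts [] [] [] = refl
Pointwise⇒restricts (a ∷ x) (b ∷ y) (r ∷ rs) rewrite Restrictsˢ⇒restrictsˢ a b r = Pointwise⇒restricts x y rs

restricts⇒Pointwise : ∀ {n} (x y : Vec Sign n) → restricts x y ≡ true → Pointwise Restrictsˢ x y
restricts⇒Pointwise [] [] _ = []
restricts⇒Pointwise (a ∷ x) (b ∷ y) p with ∧≡true⁻ {restrictsˢ a b} p
... | p1 , p2 = restrictsˢ⇒Restrictsˢ a b p1 ∷ restricts⇒Pointwise x y p2

PointwiseNeg⇒restricts : ∀ {n} (x y : Vec Sign n) → Pointwise RestrictsNegˢ x y → restricts x (negᵛ y) ≡ true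
PointwiseNeg⇒restricts [] [] [] = refl
PointwiseNeg⇒restricts (a ∷ x) (b ∷ y) (r ∷ rs) rewrite Restrictsˢ⇒restrictsˢ a (negˢ b) r = PointwiseNeg⇒restricts x y rs

restricts⇒PointwiseNeg : ∀ {n} (x y : Vec Sign n) → restricts x (negᵛ y) ≡ true → Pointwise RestrictsNegˢ x y
restricts⇒PointwiseNeg [] [] _ = []
restricts⇒PointwiseNeg (a ∷ x) (b ∷ y) p with ∧≡true⁻ {restrictsˢ a (negˢ b)} p
... | p1 , p2 = restrictsˢ⇒Restrictsˢ a (negˢ b) p1 ∷ restricts⇒PointwiseNeg x y p2

Below : ∀ {n} → Vec Sign n → Vec Sign n → Set
Below x y = restricts x y ≡ true ⊎ restricts x (negᵛ y) ≡ true

SignLeq⇒Below : ∀ {n} (x y : Vec Sign n) → SignLeq x y → Below x y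
SignLeq⇒Below x y (inj₁ p) = inj₁ (Pointwise⇒restricts x y p)
SignLeq⇒Below x y (inj₂ p) = inj₂ (PointwiseNeg⇒restricts x y p)

Below⇒SignLeq : ∀ {n} (x y : Vec Sign n) → Below x y → SignLeq x y
Below⇒SignLeq x y (inj₁ p) = inj₁ (restricts⇒Pointwise x y p)
Below⇒SignLeq x y (inj₂ p) = inj₂ (restricts⇒PointwiseNeg x y p)

restricts-negᵛʳ : ∀ {n} (x y : Vec Sign n) → restricts x (negᵛ y) ≡ restricts (negᵛ x) y
restricts-negᵛʳ x y = trans (sym (restricts-negᵛ x (negᵛ y))) (cong (restricts (negᵛ x)) (negᵛ-involutive y))

Below-trans : ∀ {n} (x y z : Vec Sign n) → Below x y → Below y z → Below x z
Below-trans x y z (inj₁ p) (inj₁ q) = inj₁ (restricts-trans x y z p q)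
Below-trans x y z (inj₁ p) (inj₂ q) = inj₂ (restricts-trans x y (negᵛ z) p q)
Below-trans x y z (inj₂ p) (inj₁ q) = inj₂ (restricts-trans x (negᵛ y) (negᵛ z) p (trans (restricts-negᵛ y z) q))
Below-trans x y z (inj₂ p) (inj₂ q) = inj₁ (restricts-trans x (negᵛ y) z p (trans (sym (restricts-negᵛʳ y z)) q))

Below⇒rankᵛ-≤ : ∀ {n} (x y : Vec Sign n) → Below x y → rankᵛ x ≤ rankᵛ y
Below⇒rankᵛ-≤ x y (inj₁ p) = restricts⇒rankᵛ-≤ x y p
Below⇒rankᵛ-≤ x y (inj₂ p) = ≤-trans (restricts⇒rankᵛ-≤ x (negᵛ y) p) (≤-reflexive (rankᵛ-negᵛ y))


startsWith⊕ : Maybe Sign → Bool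
startsWith⊕ (just ⊕) = true
startsWith⊕ (just 𝟎) = false
startsWith⊕ (just ⊖) = false
startsWith⊕ nothing = false

canonical : ∀ {n} → Vec Sign n → Bool
canonical v = startsWith⊕ (headMaybe (nonzeros v))

isCanonical?-does : ∀ {n} (v : Vec Sign n) → does (isCanonical? v) ≡ canonical v
isCanonical?-does v with headMaybe (nonzeros v)
... | just ⊕ = refl
... | just 𝟎 = refl
... | just ⊖ = refl
... | nothing = refl

IsCanonical⇒canonical : ∀ {n} (v : Vec Sign n) → IsCanonical v → canonical v ≡ true
IsCanonical⇒canonical v p rewrite p = refl

canonical⇒IsCanonical : ∀ {n} (v : Vec Sign n) → canonical v ≡ true → IsCanonical v
canonical⇒IsCanonical v p with headMaybe (nonzeros v)
... | just ⊕ = refl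
canonical⇒IsCanonical v () | just 𝟎
canonical⇒IsCanonical v () | just ⊖
canonical⇒IsCanonical v () | nothing

canonicalList : List Sign → Bool
canonicalList L = startsWith⊕ (headMaybe L)

canonical-negᵛ : ∀ {n} (v : Vec Sign n) → canonical (negᵛ v) ≡ canonicalList (map negˢ (nonzeros v))
canonical-negᵛ v = cong canonicalList (nonzeros-negᵛ v)

canonicalList-pair : ∀ L → AllNonzero L → 1 ≤ length L → 𝟙 (canonicalList L) + 𝟙 (canonicalList (map negˢ L)) ≡ 1
canonicalList-pair (⊕ ∷ L) _ _ = refl
canonicalList-pair (⊖ ∷ L) _ _ = refl
canonicalList-pair (𝟎 ∷ L) (n ∷ _) _ = ⊥-elim (n refl)

canonical-pair : ∀ {n} (v : Vec Sign n) → 1 ≤ rankᵛ v → 𝟙 (canonical v) + 𝟙 (canonical (negᵛ v)) ≡ 1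
canonical-pair v p rewrite canonical-negᵛ v = canonicalList-pair (nonzeros v) (nonzeros-allNonzero v) p

canonical⇒¬canonical-negᵛ : ∀ {n} (v : Vec Sign n) → canonical v ≡ true → canonical (negᵛ v) ≡ false
canonical⇒¬canonical-negᵛ v p rewrite canonical-negᵛ v with nonzeros v
... | ⊕ ∷ L = refl
canonical⇒¬canonical-negᵛ v () | 𝟎 ∷ L
canonical⇒¬canonical-negᵛ v () | ⊖ ∷ L
canonical⇒¬canonical-negᵛ v () | []

canonical⇒rankᵛ-pos : ∀ {n} (v : Vec Sign n) → canonical v ≡ true → 1 ≤ rankᵛ v
canonical⇒rankᵛ-pos v p with nonzeros v
... | x ∷ L = s≤s z≤n
canonical⇒rankᵛ-pos v () | []



∈-allSignVecs : ∀ {n} (v : Vec Sign n) → v ∈ allSignVecs n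
∈-allSignVecs [] = here refl
∈-allSignVecs {suc n} (𝟎 ∷ v) = ∈-++⁺ˡ (∈-map⁺ (𝟎 ∷_) (∈-allSignVecs v))
∈-allSignVecs {suc n} (⊕ ∷ v) = ∈-++⁺ʳ (map (𝟎 ∷_) (allSignVecs n)) (∈-++⁺ˡ (∈-map⁺ (⊕ ∷_) (∈-allSignVecs v)))
∈-allSignVecs {suc n} (⊖ ∷ v) = ∈-++⁺ʳ (map (𝟎 ∷_) (allSignVecs n)) (∈-++⁺ʳ (map (⊕ ∷_) (allSignVecs n)) (∈-++⁺ˡ (∈-map⁺ (⊖ ∷_) (∈-allSignVecs v))))

∑-allSignVecs-suc : ∀ n (g : Vec Sign (suc n) → ℕ) →
        ∑ (allSignVecs (suc n)) g ≡ ∑ (allSignVecs n) (λ v → g (𝟎 ∷ v)) + (∑ (allSignVecs n) (λ v → g (⊕ ∷ v)) + (∑ (allSignVecs n) (λ v → g (⊖ ∷ v)) + 0))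
∑-allSignVecs-suc n g = trans (∑-++ (map (𝟎 ∷_) (allSignVecs n)) _ g)
  (cong₂ _+_ (∑-map (𝟎 ∷_) (allSignVecs n) g) (trans (∑-++ (map (⊕ ∷_) (allSignVecs n)) _ g)
    (cong₂ _+_ (∑-map (⊕ ∷_) (allSignVecs n) g) (trans (∑-++ (map (⊖ ∷_) (allSignVecs n)) [] g)
       (cong (_+ 0) (∑-map (⊖ ∷_) (allSignVecs n) g))))))

∑-allSignVecs-negᵛ : ∀ n (g : Vec Sign n → ℕ) → ∑ (allSignVecs n) (λ v → g (negᵛ v)) ≡ ∑ (allSignVecs n) g
∑-allSignVecs-negᵛ zero g = refl
∑-allSignVecs-negᵛ (suc n) g = begin
  ∑ (allSignVecs (suc n)) (λ v → g (negᵛ v)) ≡⟨ ∑-allSignVecs-suc n (λ v → g (negᵛ v)) ⟩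
  ∑ (allSignVecs n) (λ v → g (𝟎 ∷ negᵛ v)) + (∑ (allSignVecs n) (λ v → g (⊖ ∷ negᵛ v)) + (∑ (allSignVecs n) (λ v → g (⊕ ∷ negᵛ v)) + 0))
    ≡⟨ cong₂ _+_ (∑-allSignVecs-negᵛ n (λ w → g (𝟎 ∷ w))) (cong₂ _+_ (∑-allSignVecs-negᵛ n (λ w → g (⊖ ∷ w))) (cong (_+ 0) (∑-allSignVecs-negᵛ n (λ w → g (⊕ ∷ w))))) ⟩
  ∑ (allSignVecs n) (λ v → g (𝟎 ∷ v)) + (∑ (allSignVecs n) (λ v → g (⊖ ∷ v)) + (∑ (allSignVecs n) (λ v → g (⊕ ∷ v)) + 0))
    ≡⟨ swap₂₃ (∑ (allSignVecs n) (λ v → g (𝟎 ∷ v))) (∑ (allSignVecs n) (λ v → g (⊖ ∷ v))) (∑ (allSignVecs n) (λ v → g (⊕ ∷ v))) ⟩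
  ∑ (allSignVecs n) (λ v → g (𝟎 ∷ v)) + (∑ (allSignVecs n) (λ v → g (⊕ ∷ v)) + (∑ (allSignVecs n) (λ v → g (⊖ ∷ v)) + 0))
    ≡⟨ sym (∑-allSignVecs-suc n g) ⟩
  ∑ (allSignVecs (suc n)) g ∎
  where
  open ≡-Reasoning
  swap₂₃ : ∀ a b c → a + (b + (c + 0)) ≡ a + (c + (b + 0))
  swap₂₃ = solve-∀

𝟙-≡ᵇ-≢ : ∀ a b → a ≢ b → 𝟙 (a ≡ᵇ b) ≡ 0
𝟙-≡ᵇ-≢ a b ne with a ≡ᵇ b in eq
... | false = refl
... | true = ⊥-elim (ne (≡ᵇ⇒≡ a b (subst T (sym eq) tt)))

above-lowerRank≡0 : ∀ {n} (x y : Vec Sign n) K → 𝟙 (restricts x y) * (𝟙 (suc (rankᵛ y) ≡ᵇ rankᵛ x) * K) ≡ 0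
above-lowerRank≡0 x y K with restricts x y in eq
... | false = refl
... | true rewrite 𝟙-≡ᵇ-≢ (suc (rankᵛ y)) (rankᵛ x) (λ e → <-irrefl (sym e) (s≤s (restricts⇒rankᵛ-≤ x y eq))) = refl

below-higherRank≡0 : ∀ {n} (x y : Vec Sign n) K → 𝟙 (restricts y x) * (𝟙 (rankᵛ y ≡ᵇ suc (rankᵛ x)) * K) ≡ 0
below-higherRank≡0 x y K with restricts y x in eq
... | false = refl
... | true rewrite 𝟙-≡ᵇ-≢ (rankᵛ y) (suc (rankᵛ x)) (λ e → <-irrefl e (s≤s (restricts⇒rankᵛ-≤ y x eq))) = refl

∑-allSignVecs-zero : ∀ n (g : Vec Sign n → ℕ) → (∀ y → g y ≡ 0) → ∑ (allSignVecs n) g ≡ 0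
∑-allSignVecs-zero n g e = ∑-zero (allSignVecs n) (λ y _ → e y)

1*[1*m]+0≡m : ∀ m → 1 * (1 * m) + 0 ≡ m
1*[1*m]+0≡m = solve-∀

∑-above-sameRank : ∀ n (x : Vec Sign n) (k : Vec Sign n → ℕ) →
        ∑ (allSignVecs n) (λ y → 𝟙 (restricts x y) * (𝟙 (rankᵛ y ≡ᵇ rankᵛ x) * k y)) ≡ k x
∑-above-sameRank zero [] k = 1*[1*m]+0≡m (k [])
∑-above-sameRank (suc n) (𝟎 ∷ x) k = trans (∑-allSignVecs-suc n _) (trans (cong₂ _+_ (∑-above-sameRank n x (λ y → k (𝟎 ∷ y)))
   (cong₂ _+_ (∑-zero (allSignVecs n) (λ y _ → above-lowerRank≡0 x y (k (⊕ ∷ y)))) (cong (_+ 0) (∑-zero (allSignVecs n) (λ y _ → above-lowerRank≡0 x y (k (⊖ ∷ y)))))))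
   (+-identityʳ (k (𝟎 ∷ x))))
∑-above-sameRank (suc n) (⊕ ∷ x) k = trans (∑-allSignVecs-suc n _) (trans (cong₂ _+_ (∑-allSignVecs-zero n _ (λ _ → refl)) (cong₂ _+_ (∑-above-sameRank n x (λ y → k (⊕ ∷ y))) (cong (_+ 0) (∑-allSignVecs-zero n _ (λ _ → refl)))))
   (+-identityʳ (k (⊕ ∷ x))))
∑-above-sameRank (suc n) (⊖ ∷ x) k = trans (∑-allSignVecs-suc n _) (trans (cong₂ _+_ (∑-allSignVecs-zero n _ (λ _ → refl)) (cong₂ _+_ (∑-allSignVecs-zero n _ (λ _ → refl)) (cong (_+ 0) (∑-above-sameRank n x (λ y → k (⊖ ∷ y))))))
   (+-identityʳ (k (⊖ ∷ x))))

∑-below-sameRank : ∀ n (x : Vec Sign n) (k : Vec Sign n → ℕ) →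
        ∑ (allSignVecs n) (λ y → 𝟙 (restricts y x) * (𝟙 (rankᵛ y ≡ᵇ rankᵛ x) * k y)) ≡ k x
∑-below-sameRank zero [] k = 1*[1*m]+0≡m (k [])
∑-below-sameRank (suc n) (𝟎 ∷ x) k = trans (∑-allSignVecs-suc n _) (trans (cong₂ _+_ (∑-below-sameRank n x (λ y → k (𝟎 ∷ y))) (cong₂ _+_ (∑-allSignVecs-zero n _ (λ _ → refl)) (cong (_+ 0) (∑-allSignVecs-zero n _ (λ _ → refl)))))
   (+-identityʳ (k (𝟎 ∷ x))))
∑-below-sameRank (suc n) (⊕ ∷ x) k = trans (∑-allSignVecs-suc n _) (trans (cong₂ _+_ (∑-zero (allSignVecs n) (λ y _ → below-higherRank≡0 x y (k (𝟎 ∷ y))))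
   (cong₂ _+_ (∑-below-sameRank n x (λ y → k (⊕ ∷ y))) (cong (_+ 0) (∑-allSignVecs-zero n _ (λ _ → refl)))))
   (+-identityʳ (k (⊕ ∷ x))))
∑-below-sameRank (suc n) (⊖ ∷ x) k = trans (∑-allSignVecs-suc n _) (trans (cong₂ _+_ (∑-zero (allSignVecs n) (λ y _ → below-higherRank≡0 x y (k (𝟎 ∷ y))))
   (cong₂ _+_ (∑-allSignVecs-zero n _ (λ _ → refl)) (cong (_+ 0) (∑-below-sameRank n x (λ y → k (⊖ ∷ y))))))
   (+-identityʳ (k (⊖ ∷ x))))

Pair : ℕ → Set
Pair n = Vec Sign n × Vec Sign n

consPair : ∀ {n} → Sign → Pair n → Pair (suc n)
consPair a (u , v) = (a ∷ u , a ∷ v)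

-- The upper covers of x among sign vectors come in pairs: set one zero
-- coordinate of x to ⊕ or to ⊖.
extensionPairs : ∀ {n} → Vec Sign n → List (Pair n)
extensionPairs [] = []
extensionPairs (𝟎 ∷ x) = (⊕ ∷ x , ⊖ ∷ x) ∷ map (consPair 𝟎) (extensionPairs x)
extensionPairs (⊕ ∷ x) = map (consPair ⊕) (extensionPairs x)
extensionPairs (⊖ ∷ x) = map (consPair ⊖) (extensionPairs x)

deletions : ∀ {n} → Vec Sign n → List (Vec Sign n)
deletions [] = []
deletions (𝟎 ∷ x) = map (𝟎 ∷_) (deletions x)
deletions (⊕ ∷ x) = (𝟎 ∷ x) ∷ map (⊕ ∷_) (deletions x)
deletions (⊖ ∷ x) = (𝟎 ∷ x) ∷ map (⊖ ∷_) (deletions x)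

pairSum : ∀ {n} → (Vec Sign n → ℕ) → Pair n → ℕ
pairSum h p = h (proj₁ p) + h (proj₂ p)

∑-above-rankSuc : ∀ n (x : Vec Sign n) (h : Vec Sign n → ℕ) →
          ∑ (allSignVecs n) (λ y → 𝟙 (restricts x y) * (𝟙 (rankᵛ y ≡ᵇ suc (rankᵛ x)) * h y)) ≡ ∑ (extensionPairs x) (pairSum h)
∑-above-rankSuc zero [] h = refl
∑-above-rankSuc (suc n) (𝟎 ∷ x) h = trans (∑-allSignVecs-suc n _) (trans (cong₂ _+_ (∑-above-rankSuc n x (λ y → h (𝟎 ∷ y)))
   (cong₂ _+_ (∑-above-sameRank n x (λ y → h (⊕ ∷ y))) (cong (_+ 0) (∑-above-sameRank n x (λ y → h (⊖ ∷ y))))))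
   (trans (rotate _ (h (⊕ ∷ x)) (h (⊖ ∷ x))) (cong (h (⊕ ∷ x) + h (⊖ ∷ x) +_) (sym (∑-map (consPair 𝟎) (extensionPairs x) (pairSum h))))))
  where rotate : ∀ a b c → a + (b + (c + 0)) ≡ (b + c) + a
        rotate = solve-∀
∑-above-rankSuc (suc n) (⊕ ∷ x) h = trans (∑-allSignVecs-suc n _) (trans (cong₂ _+_ (∑-allSignVecs-zero n _ (λ _ → refl)) (cong₂ _+_ (∑-above-rankSuc n x (λ y → h (⊕ ∷ y))) (cong (_+ 0) (∑-allSignVecs-zero n _ (λ _ → refl)))))
   (trans (+-identityʳ _) (sym (∑-map (consPair ⊕) (extensionPairs x) (pairSum h)))))
∑-above-rankSuc (suc n) (⊖ ∷ x) h = trans (∑-allSignVecs-suc n _) (trans (cong₂ _+_ (∑-allSignVecs-zero n _ (λ _ → refl)) (cong₂ _+_ (∑-allSignVecs-zero n _ (λ _ → refl)) (cong (_+ 0) (∑-above-rankSuc n x (λ y → h (⊖ ∷ y))))))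
   (trans (+-identityʳ _) (sym (∑-map (consPair ⊖) (extensionPairs x) (pairSum h)))))

∑-below-rankPred : ∀ n (x : Vec Sign n) (h : Vec Sign n → ℕ) →
          ∑ (allSignVecs n) (λ y → 𝟙 (restricts y x) * (𝟙 (suc (rankᵛ y) ≡ᵇ rankᵛ x) * h y)) ≡ ∑ (deletions x) h
∑-below-rankPred zero [] h = refl
∑-below-rankPred (suc n) (𝟎 ∷ x) h = trans (∑-allSignVecs-suc n _) (trans (cong₂ _+_ (∑-below-rankPred n x (λ y → h (𝟎 ∷ y))) (cong₂ _+_ (∑-allSignVecs-zero n _ (λ _ → refl)) (cong (_+ 0) (∑-allSignVecs-zero n _ (λ _ → refl)))))
   (trans (+-identityʳ _) (sym (∑-map (𝟎 ∷_) (deletions x) h))))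
∑-below-rankPred (suc n) (⊕ ∷ x) h = trans (∑-allSignVecs-suc n _) (trans (cong₂ _+_ (∑-below-sameRank n x (λ y → h (𝟎 ∷ y)))
   (cong₂ _+_ (∑-below-rankPred n x (λ y → h (⊕ ∷ y))) (cong (_+ 0) (∑-allSignVecs-zero n _ (λ _ → refl)))))
   (trans (cong (h (𝟎 ∷ x) +_) (+-identityʳ _)) (cong (h (𝟎 ∷ x) +_) (sym (∑-map (⊕ ∷_) (deletions x) h)))))
∑-below-rankPred (suc n) (⊖ ∷ x) h = trans (∑-allSignVecs-suc n _) (trans (cong₂ _+_ (∑-below-sameRank n x (λ y → h (𝟎 ∷ y)))
   (cong₂ _+_ (∑-allSignVecs-zero n _ (λ _ → refl)) (cong (_+ 0) (∑-below-rankPred n x (λ y → h (⊖ ∷ y))))))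
   (trans (cong (h (𝟎 ∷ x) +_) (+-identityʳ _)) (cong (h (𝟎 ∷ x) +_) (sym (∑-map (⊖ ∷_) (deletions x) h)))))

length-extensionPairs : ∀ {n} (x : Vec Sign n) → length (extensionPairs x) ≡ n ∸ rankᵛ x
length-extensionPairs [] = refl
length-extensionPairs {suc n} (𝟎 ∷ x) = trans (cong suc (trans (length-map (consPair 𝟎) (extensionPairs x)) (length-extensionPairs x)))
                               (sym (+-∸-assoc 1 (rankᵛ≤n x)))
length-extensionPairs (⊕ ∷ x) = trans (length-map (consPair ⊕) (extensionPairs x)) (length-extensionPairs x)
length-extensionPairs (⊖ ∷ x) = trans (length-map (consPair ⊖) (extensionPairs x)) (length-extensionPairs x)

length-deletions : ∀ {n} (x : Vec Sign n) → length (deletions x) ≡ rankᵛ x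
length-deletions [] = refl
length-deletions (𝟎 ∷ x) = trans (length-map (𝟎 ∷_) (deletions x)) (length-deletions x)
length-deletions (⊕ ∷ x) = cong suc (trans (length-map (⊕ ∷_) (deletions x)) (length-deletions x))
length-deletions (⊖ ∷ x) = cong suc (trans (length-map (⊖ ∷_) (deletions x)) (length-deletions x))


T⇒≡true : ∀ {b} → T b → b ≡ true
T⇒≡true {true} _ = refl

≡true⇒T : ∀ {b} → b ≡ true → T b
≡true⇒T refl = tt

∨≡true⁻ : ∀ {a b} → a ∨ b ≡ true → a ≡ true ⊎ b ≡ true
∨≡true⁻ {true} _ = inj₁ refl
∨≡true⁻ {false} p = inj₂ p

does-≤? : ∀ a b → does (a ≤? b) ≡ (a ≤ᵇ b)
does-≤? a b = does-≡ (a ≤? b) (a ≤ᵇ b) (λ p → T⇒≡true (≤⇒≤ᵇ p)) (λ p → ≤ᵇ⇒≤ a b (≡true⇒T p))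

≡ᵇ-sym : ∀ a b → (a ≡ᵇ b) ≡ (b ≡ᵇ a)
≡ᵇ-sym zero zero = refl
≡ᵇ-sym zero (suc b) = refl
≡ᵇ-sym (suc a) zero = refl
≡ᵇ-sym (suc a) (suc b) = ≡ᵇ-sym a b

≡ᵇ≡true⇒≡ : ∀ a b → (a ≡ᵇ b) ≡ true → a ≡ b
≡ᵇ≡true⇒≡ a b p = ≡ᵇ⇒≡ a b (≡true⇒T p)

restricts-both⇒rankᵛ≡0 : ∀ {n} (x y : Vec Sign n) → restricts x y ≡ true → restricts x (negᵛ y) ≡ true → rankᵛ x ≡ 0
restricts-both⇒rankᵛ≡0 [] [] _ _ = refl
restricts-both⇒rankᵛ≡0 (𝟎 ∷ x) (b ∷ y) p q = restricts-both⇒rankᵛ≡0 x y (proj₂ (∧≡true⁻ {restrictsˢ 𝟎 b} p)) (proj₂ (∧≡true⁻ {restrictsˢ 𝟎 (negˢ b)} q))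
restricts-both⇒rankᵛ≡0 (⊕ ∷ x) (⊕ ∷ y) p ()
restricts-both⇒rankᵛ≡0 (⊕ ∷ x) (⊖ ∷ y) () q
restricts-both⇒rankᵛ≡0 (⊕ ∷ x) (𝟎 ∷ y) () q
restricts-both⇒rankᵛ≡0 (⊖ ∷ x) (⊖ ∷ y) p ()
restricts-both⇒rankᵛ≡0 (⊖ ∷ x) (⊕ ∷ y) () q
restricts-both⇒rankᵛ≡0 (⊖ ∷ x) (𝟎 ∷ y) () q

Below-negᵛˡ : ∀ {n} (x y : Vec Sign n) → Below x y → Below (negᵛ x) y
Below-negᵛˡ x y (inj₁ p) = inj₂ (trans (restricts-negᵛ x y) p)
Below-negᵛˡ x y (inj₂ p) = inj₁ (trans (sym (restricts-negᵛʳ x y)) p)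

Below-negᵛʳ : ∀ {n} (x y : Vec Sign n) → Below x y → Below x (negᵛ y)
Below-negᵛʳ x y (inj₁ p) = inj₂ (trans (cong (restricts x) (negᵛ-involutive y)) p)
Below-negᵛʳ x y (inj₂ p) = inj₁ p

canonicalRep : ∀ {n} → Vec Sign n → Vec Sign n
canonicalRep z = if canonical z then z else negᵛ z

canonicalRep-cases : ∀ {n} (z : Vec Sign n) → (canonicalRep z ≡ z) ⊎ (canonicalRep z ≡ negᵛ z)
canonicalRep-cases z with canonical z
... | true = inj₁ refl
... | false = inj₂ refl

canonicalRep-canonical : ∀ {n} (z : Vec Sign n) → 1 ≤ rankᵛ z → canonical (canonicalRep z) ≡ true
canonicalRep-canonical z r with canonical z in eq
... | true = eq
... | false with canonical-pair z r
...   | e rewrite eq with canonical (negᵛ z)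
...     | true = refl
canonicalRep-canonical z r | false | () | false

canonicalRep-rankᵛ : ∀ {n} (z : Vec Sign n) → rankᵛ (canonicalRep z) ≡ rankᵛ z
canonicalRep-rankᵛ z with canonicalRep-cases z
... | inj₁ e = cong rankᵛ e
... | inj₂ e = trans (cong rankᵛ e) (rankᵛ-negᵛ z)

canonicalRep-signChanges : ∀ {n} (z : Vec Sign n) → signChanges (canonicalRep z) ≡ signChanges z
canonicalRep-signChanges z with canonicalRep-cases z
... | inj₁ e = cong signChanges e
... | inj₂ e = trans (cong signChanges e) (signChanges-negᵛ z)

Below-canonʳ : ∀ {n} (x z : Vec Sign n) → Below x z → Below x (canonicalRep z)
Below-canonʳ x z p with canonicalRep-cases z
... | inj₁ e rewrite e = p
... | inj₂ e rewrite e = Below-negᵛʳ x z p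

Below-canonˡ : ∀ {n} (z y : Vec Sign n) → Below z y → Below (canonicalRep z) y
Below-canonˡ z y p with canonicalRep-cases z
... | inj₁ e rewrite e = p
... | inj₂ e rewrite e = Below-negᵛˡ z y p


-- The posets P n l

module SignPoset (n l : ℕ) where
  Elems : List (Vec Sign n)
  Elems = filter (inP? l) (allSignVecs n)

  inPᵇ : Vec Sign n → Bool
  inPᵇ v = canonical v ∧ (signChanges v ≤ᵇ l)

  inP?-does : ∀ v → does (inP? l v) ≡ inPᵇ v
  inP?-does v = cong₂ _∧_ (isCanonical?-does v) (does-≤? (signChanges v) l)

  Elems⁻ : ∀ {v} → v ∈ Elems → InP l v
  Elems⁻ p = proj₂ (∈-filter⁻ (inP? l) {xs = allSignVecs n} p)

  Elems⁺ : ∀ {v} → InP l v → v ∈ Elems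
  Elems⁺ {v} p = ∈-filter⁺ (inP? l) (∈-allSignVecs v) p

  Elems-canonical : ∀ {v} → v ∈ Elems → canonical v ≡ true
  Elems-canonical {v} p = IsCanonical⇒canonical v (proj₁ (Elems⁻ p))

  Elems-signChanges : ∀ {v} → v ∈ Elems → signChanges v ≤ l
  Elems-signChanges p = proj₂ (Elems⁻ p)

  Elems⁺′ : ∀ {v} → canonical v ≡ true → signChanges v ≤ l → v ∈ Elems
  Elems⁺′ {v} c h = Elems⁺ (canonical⇒IsCanonical v c , h)

  Elems-rankᵛ : ∀ {v} → v ∈ Elems → 1 ≤ rankᵛ v × rankᵛ v ≤ n
  Elems-rankᵛ {v} p = canonical⇒rankᵛ-pos v (Elems-canonical p) , rankᵛ≤n v

  Below-sameRank⇒≡ : ∀ {x y} → x ∈ Elems → y ∈ Elems → Below x y → rankᵛ x ≡ rankᵛ y → x ≡ y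
  Below-sameRank⇒≡ {x} {y} xE yE (inj₁ p) e = restricts-rankᵛ-≡⇒≡ x y p e
  Below-sameRank⇒≡ {x} {y} xE yE (inj₂ p) e with restricts-rankᵛ-≡⇒≡ x (negᵛ y) p (trans e (sym (rankᵛ-negᵛ y)))
  ... | refl with trans (sym (Elems-canonical xE)) (canonical⇒¬canonical-negᵛ y (Elems-canonical yE))
  ...   | ()

  Covers : Vec Sign n → Vec Sign n → Set
  Covers = _⋖_ (P n l)

  covers? : (x y : Vec Sign n) → Dec (Covers x y)
  covers? = _⋖?_ (P n l)

  Below⇒restricts-representative : ∀ {x y} → Below x y → Σ (Vec Sign n) λ y' → restricts x y' ≡ true × rankᵛ y' ≡ rankᵛ y ×
          (∀ z → restricts z y' ≡ true → Below z y) × signChanges y' ≡ signChanges y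
  Below⇒restricts-representative {x} {y} (inj₁ p) = y , p , refl , (λ z q → inj₁ q) , refl
  Below⇒restricts-representative {x} {y} (inj₂ p) = negᵛ y , p , rankᵛ-negᵛ y , (λ z q → inj₂ q) , signChanges-negᵛ y

  -- If the rank jumped by 2 or more, a vector strictly between x and y, taken
  -- in canonical form, would lie in P n l (its sign changes are at most those
  -- of y) and contradict the cover.
  Covers⇒rankᵛ-suc : ∀ {x y} → x ∈ Elems → y ∈ Elems → Covers x y → rankᵛ y ≡ suc (rankᵛ x)
  Covers⇒rankᵛ-suc {x} {y} xE yE (sxy , x≢y , allz) with m≤n⇒m<n∨m≡n lt
    where
    lxy = SignLeq⇒Below x y sxy
    lt : rankᵛ x < rankᵛ y
    lt = ≤∧≢⇒< (Below⇒rankᵛ-≤ x y lxy) (λ e → x≢y (Below-sameRank⇒≡ xE yE lxy e))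
  ... | inj₂ e = sym e
  ... | inj₁ lt2 with Below⇒restricts-representative {x} {y} (SignLeq⇒Below x y sxy)
  ...   | y' , p , ry' , back , chy' with restricts-interpolate x y' p (subst (rankᵛ x <_) (sym ry') (≤-trans (n≤1+n _) lt2))
  ...     | z , sxz , szy' , ez = ⊥-elim (contra (All.lookup allz z*E (Below⇒SignLeq x z* lxz*) (Below⇒SignLeq z* y lz*y)))
    where
    z* = canonicalRep z
    rz : rankᵛ x < rankᵛ z
    rz = ≤-pred (subst (suc (rankᵛ x) <_) (sym (trans ez ry')) lt2)
    z*E : z* ∈ Elems
    z*E = Elems⁺′ (canonicalRep-canonical z (≤-trans (s≤s z≤n) rz))
              (≤-trans (≤-reflexive (canonicalRep-signChanges z)) (≤-trans (restricts⇒signChanges-≤ z y' szy') (≤-trans (≤-reflexive chy') (Elems-signChanges yE))))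
    lxz* : Below x z*
    lxz* = Below-canonʳ x z (inj₁ sxz)
    lz*y : Below z* y
    lz*y = Below-canonˡ z y (back z szy')
    contra : z* ≡ x ⊎ z* ≡ y → ⊥
    contra (inj₁ e) = <-irrefl (sym (trans (sym (canonicalRep-rankᵛ z)) (cong rankᵛ e))) rz
    contra (inj₂ e) = <-irrefl (trans (sym (canonicalRep-rankᵛ z)) (trans (cong rankᵛ e) (sym (trans ez ry')))) (n<1+n (rankᵛ z))

  rankᵛ-suc⇒Covers : ∀ {x y} → x ∈ Elems → y ∈ Elems → Below x y → rankᵛ y ≡ suc (rankᵛ x) → Covers x y
  rankᵛ-suc⇒Covers {x} {y} xE yE lxy e = Below⇒SignLeq x y lxy , (λ eq → <-irrefl (cong rankᵛ eq) (subst (rankᵛ x <_) (sym e) (n<1+n _))) ,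
      All.tabulate (λ {z} zE lxz lzy → h zE (SignLeq⇒Below x z lxz) (SignLeq⇒Below z y lzy))
    where
    h : ∀ {z} → z ∈ Elems → Below x z → Below z y → z ≡ x ⊎ z ≡ y
    h {z} zE lxz lzy with m≤n⇒m<n∨m≡n (Below⇒rankᵛ-≤ x z lxz)
    ... | inj₂ e' = inj₁ (sym (Below-sameRank⇒≡ xE zE lxz e'))
    ... | inj₁ lt = inj₂ (Below-sameRank⇒≡ zE yE lzy (≤-antisym (Below⇒rankᵛ-≤ z y lzy) (subst (_≤ rankᵛ z) (sym e) lt)))

  coversᵇ : Vec Sign n → Vec Sign n → Bool
  coversᵇ x y = (restricts x y ∨ restricts x (negᵛ y)) ∧ (rankᵛ y ≡ᵇ suc (rankᵛ x))

  covers?-does : ∀ {x y} → x ∈ Elems → y ∈ Elems → does (covers? x y) ≡ coversᵇ x y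
  covers?-does {x} {y} xE yE = does-≡ (covers? x y) (coversᵇ x y)
    (λ c → fwd (SignLeq⇒Below x y (proj₁ c)) (Covers⇒rankᵛ-suc xE yE c))
    (λ b → rankᵛ-suc⇒Covers xE yE (bl (proj₁ (∧≡true⁻ {restricts x y ∨ restricts x (negᵛ y)} b)))
                       (≡ᵇ≡true⇒≡ (rankᵛ y) (suc (rankᵛ x)) (proj₂ (∧≡true⁻ {restricts x y ∨ restricts x (negᵛ y)} b))))
    where
    fwd : Below x y → rankᵛ y ≡ suc (rankᵛ x) → coversᵇ x y ≡ true
    fwd (inj₁ p) e rewrite p | e = T⇒≡true (≡⇒≡ᵇ (rankᵛ x) (rankᵛ x) refl)
    fwd (inj₂ p) e rewrite p | e | ∨-zeroʳ (restricts x y) = T⇒≡true (≡⇒≡ᵇ (rankᵛ x) (rankᵛ x) refl)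
    bl : (restricts x y ∨ restricts x (negᵛ y)) ≡ true → Below x y
    bl b = ∨≡true⁻ b

  -- The indicator of y ∈ P n l ∧ x ⋖ y, split into its Boolean ingredients.
  𝟙-cover-split : ∀ (c e s₁ s₂ q d : Bool) (F : ℕ) → (c ∧ e ≡ true → s₁ ≡ true → s₂ ≡ true → ⊥) →
                  (c ∧ e ≡ true → d ≡ (s₁ ∨ s₂) ∧ q) →
                  𝟙 (c ∧ e) * (𝟙 d * F) ≡ 𝟙 c * ((𝟙 s₁ + 𝟙 s₂) * (𝟙 e * (𝟙 q * F)))
  𝟙-cover-split false e     s₁ s₂ q d F _ _ = refl
  𝟙-cover-split true  false s₁ s₂ q d F _ _ = sym (trans (+-identityʳ _) (*-zeroʳ (𝟙 s₁ + 𝟙 s₂)))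
  𝟙-cover-split true  true  s₁ s₂ q d F excl d≡ rewrite d≡ refl = cong (1 *_) (split s₁ s₂ (excl refl))
    where
    split : ∀ s₁ s₂ → (s₁ ≡ true → s₂ ≡ true → ⊥) → 𝟙 ((s₁ ∨ s₂) ∧ q) * F ≡ (𝟙 s₁ + 𝟙 s₂) * (1 * (𝟙 q * F))
    split true  true  excl = ⊥-elim (excl refl refl)
    split true  false _    = one (𝟙 q) F
      where one : ∀ a b → a * b ≡ (1 + 0) * (1 * (a * b))
            one = solve-∀
    split false true  _    = one (𝟙 q) F
      where one : ∀ a b → a * b ≡ (0 + 1) * (1 * (a * b))
            one = solve-∀
    split false false _    = none (𝟙 q) F
      where none : ∀ a b → 0 * b ≡ (0 + 0) * (1 * (a * b))
            none = solve-∀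

  inPᵇ⇒Elems : ∀ {v} → canonical v ∧ (signChanges v ≤ᵇ l) ≡ true → v ∈ Elems
  inPᵇ⇒Elems {v} p = Elems⁺′ (proj₁ (∧≡true⁻ {canonical v} p)) (≤ᵇ⇒≤ (signChanges v) l (≡true⇒T (proj₂ (∧≡true⁻ {canonical v} p))))

  outflow-pointwise : ∀ (f : Vec Sign n → Vec Sign n → ℕ) {x} y → x ∈ Elems →
           𝟙 (does (inP? l y)) * (𝟙 (does (covers? x y)) * f x y) ≡
           𝟙 (canonical y) * ((𝟙 (restricts x y) + 𝟙 (restricts x (negᵛ y))) * (𝟙 (signChanges y ≤ᵇ l) * (𝟙 (rankᵛ y ≡ᵇ suc (rankᵛ x)) * f x y)))
  outflow-pointwise f {x} y xE = trans (cong (λ b → 𝟙 b * (𝟙 (does (covers? x y)) * f x y)) (inP?-does y))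
    (𝟙-cover-split (canonical y) (signChanges y ≤ᵇ l) (restricts x y) (restricts x (negᵛ y)) (rankᵛ y ≡ᵇ suc (rankᵛ x)) (does (covers? x y)) (f x y)
       (λ _ p q → <-irrefl (sym (restricts-both⇒rankᵛ≡0 x y p q)) (proj₁ (Elems-rankᵛ xE)))
       (λ ce → covers?-does {x} {y} xE (inPᵇ⇒Elems {y} ce)))

  inflow-pointwise : ∀ (f : Vec Sign n → Vec Sign n → ℕ) x {y} → y ∈ Elems →
           𝟙 (does (inP? l x)) * (𝟙 (does (covers? x y)) * f x y) ≡
           𝟙 (canonical x) * ((𝟙 (restricts x y) + 𝟙 (restricts (negᵛ x) y)) * (𝟙 (signChanges x ≤ᵇ l) * (𝟙 (suc (rankᵛ x) ≡ᵇ rankᵛ y) * f x y)))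
  inflow-pointwise f x {y} yE = trans (cong (λ b → 𝟙 b * (𝟙 (does (covers? x y)) * f x y)) (inP?-does x))
    (𝟙-cover-split (canonical x) (signChanges x ≤ᵇ l) (restricts x y) (restricts (negᵛ x) y) (suc (rankᵛ x) ≡ᵇ rankᵛ y) (does (covers? x y)) (f x y)
       (λ ce p q → <-irrefl (sym (restricts-both⇒rankᵛ≡0 x y p (trans (restricts-negᵛʳ x y) q))) (proj₁ (Elems-rankᵛ (inPᵇ⇒Elems {x} ce))))
       (λ ce → trans (covers?-does {x} {y} (inPᵇ⇒Elems {x} ce) yE) (cong₂ _∧_ (cong (restricts x y ∨_) (restricts-negᵛʳ x y)) (≡ᵇ-sym (rankᵛ y) (suc (rankᵛ x))))))

  -- Summing over canonical vectors both orientations of a symmetric quantity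
  -- is the same as summing over all sign vectors once.
  ∑-canonical-symmetric : ∀ (G : Vec Sign n → ℕ) (B : Vec Sign n → Bool) → (∀ v → G (negᵛ v) ≡ G v) → (∀ v → rankᵛ v ≡ 0 → G v ≡ 0) →
           ∑ (allSignVecs n) (λ v → 𝟙 (canonical v) * ((𝟙 (B v) + 𝟙 (B (negᵛ v))) * G v)) ≡ ∑ (allSignVecs n) (λ v → 𝟙 (B v) * G v)
  ∑-canonical-symmetric G B Ginv G-rank0 = begin
    ∑ (allSignVecs n) (λ v → 𝟙 (canonical v) * ((𝟙 (B v) + 𝟙 (B (negᵛ v))) * G v))
      ≡⟨ ∑-cong (allSignVecs n) (λ v _ → distrib (𝟙 (canonical v)) (𝟙 (B v)) (𝟙 (B (negᵛ v))) (G v)) ⟩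
    ∑ (allSignVecs n) (λ v → 𝟙 (canonical v) * (𝟙 (B v) * G v) + 𝟙 (canonical v) * (𝟙 (B (negᵛ v)) * G v))
      ≡⟨ ∑-+ (allSignVecs n) _ _ ⟩
    ∑ (allSignVecs n) (λ v → 𝟙 (canonical v) * (𝟙 (B v) * G v)) + ∑ (allSignVecs n) (λ v → 𝟙 (canonical v) * (𝟙 (B (negᵛ v)) * G v))
      ≡⟨ cong (∑ (allSignVecs n) (λ v → 𝟙 (canonical v) * (𝟙 (B v) * G v)) +_) reindex ⟩
    ∑ (allSignVecs n) (λ v → 𝟙 (canonical v) * (𝟙 (B v) * G v)) + ∑ (allSignVecs n) (λ v → 𝟙 (canonical (negᵛ v)) * (𝟙 (B v) * G v))
      ≡⟨ sym (∑-+ (allSignVecs n) _ _) ⟩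
    ∑ (allSignVecs n) (λ v → 𝟙 (canonical v) * (𝟙 (B v) * G v) + 𝟙 (canonical (negᵛ v)) * (𝟙 (B v) * G v))
      ≡⟨ ∑-cong (allSignVecs n) (λ v _ → pair v) ⟩
    ∑ (allSignVecs n) (λ v → 𝟙 (B v) * G v) ∎
    where
    open ≡-Reasoning
    distrib : ∀ c a b g → c * ((a + b) * g) ≡ c * (a * g) + c * (b * g)
    distrib = solve-∀
    h : Vec Sign n → ℕ
    h w = 𝟙 (canonical w) * (𝟙 (B (negᵛ w)) * G w)
    reindex : ∑ (allSignVecs n) (λ v → 𝟙 (canonical v) * (𝟙 (B (negᵛ v)) * G v)) ≡ ∑ (allSignVecs n) (λ v → 𝟙 (canonical (negᵛ v)) * (𝟙 (B v) * G v))
    reindex = sym (trans (∑-cong (allSignVecs n) (λ v _ → cong₂ (λ a b → 𝟙 (canonical (negᵛ v)) * (𝟙 (B a) * b)) (sym (negᵛ-involutive v)) (sym (Ginv v))))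
                        (∑-allSignVecs-negᵛ n h))
    pair : ∀ v → 𝟙 (canonical v) * (𝟙 (B v) * G v) + 𝟙 (canonical (negᵛ v)) * (𝟙 (B v) * G v) ≡ 𝟙 (B v) * G v
    pair v with rankᵛ v ≟ 0
    ... | yes z rewrite G-rank0 v z | *-zeroʳ (𝟙 (B v)) | *-zeroʳ (𝟙 (canonical v)) | *-zeroʳ (𝟙 (canonical (negᵛ v))) = refl
    ... | no rank≢0 = trans (sym (*-distribʳ-+ (𝟙 (B v) * G v) (𝟙 (canonical v)) (𝟙 (canonical (negᵛ v)))))
                   (trans (cong (_* (𝟙 (B v) * G v)) (canonical-pair v (n≢0⇒n>0 rank≢0))) (*-identityˡ _))

  outflow≡∑extensions : ∀ (f : Vec Sign n → Vec Sign n → ℕ) → (∀ x y → f x (negᵛ y) ≡ f x y) → ∀ {x} → x ∈ Elems →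
            ∑ (filter (covers? x) Elems) (f x) ≡ ∑ (extensionPairs x) (pairSum (λ y → 𝟙 (signChanges y ≤ᵇ l) * f x y))
  outflow≡∑extensions f finv {x} xE = begin
    ∑ (filter (covers? x) Elems) (f x) ≡⟨ ∑-filter (covers? x) Elems (f x) ⟩
    ∑ Elems (λ y → 𝟙 (does (covers? x y)) * f x y) ≡⟨ ∑-filter (inP? l) (allSignVecs n) _ ⟩
    ∑ (allSignVecs n) (λ y → 𝟙 (does (inP? l y)) * (𝟙 (does (covers? x y)) * f x y)) ≡⟨ ∑-cong (allSignVecs n) (λ y _ → outflow-pointwise f y xE) ⟩
    ∑ (allSignVecs n) (λ y → 𝟙 (canonical y) * ((𝟙 (restricts x y) + 𝟙 (restricts x (negᵛ y))) * G y))
      ≡⟨ ∑-canonical-symmetric G (restricts x) Ginv G-rank0 ⟩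
    ∑ (allSignVecs n) (λ y → 𝟙 (restricts x y) * G y) ≡⟨ ∑-cong (allSignVecs n) (λ y _ → swap₂₃ (𝟙 (restricts x y)) (𝟙 (signChanges y ≤ᵇ l)) (𝟙 (rankᵛ y ≡ᵇ suc (rankᵛ x))) (f x y)) ⟩
    ∑ (allSignVecs n) (λ y → 𝟙 (restricts x y) * (𝟙 (rankᵛ y ≡ᵇ suc (rankᵛ x)) * (𝟙 (signChanges y ≤ᵇ l) * f x y))) ≡⟨ ∑-above-rankSuc n x _ ⟩
    ∑ (extensionPairs x) (pairSum (λ y → 𝟙 (signChanges y ≤ᵇ l) * f x y)) ∎
    where
    open ≡-Reasoning
    G : Vec Sign n → ℕ
    G y = 𝟙 (signChanges y ≤ᵇ l) * (𝟙 (rankᵛ y ≡ᵇ suc (rankᵛ x)) * f x y)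
    Ginv : ∀ v → G (negᵛ v) ≡ G v
    Ginv v rewrite signChanges-negᵛ v | rankᵛ-negᵛ v | finv x v = refl
    G-rank0 : ∀ v → rankᵛ v ≡ 0 → G v ≡ 0
    G-rank0 v z rewrite z = *-zeroʳ (𝟙 (signChanges v ≤ᵇ l))
    swap₂₃ : ∀ a b c m → a * (b * (c * m)) ≡ a * (c * (b * m))
    swap₂₃ = solve-∀

  inflow≡∑deletions : ∀ (f : Vec Sign n → Vec Sign n → ℕ) → (∀ x y → f (negᵛ x) y ≡ f x y) → ∀ {y} → y ∈ Elems → 2 ≤ rankᵛ y →
            ∑ (filter (λ x → covers? x y) Elems) (λ x → f x y) ≡ ∑ (deletions y) (λ x → 𝟙 (signChanges x ≤ᵇ l) * f x y)
  inflow≡∑deletions f finv {y} yE r2 = begin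
    ∑ (filter (λ x → covers? x y) Elems) (λ x → f x y) ≡⟨ ∑-filter (λ x → covers? x y) Elems (λ x → f x y) ⟩
    ∑ Elems (λ x → 𝟙 (does (covers? x y)) * f x y) ≡⟨ ∑-filter (inP? l) (allSignVecs n) _ ⟩
    ∑ (allSignVecs n) (λ x → 𝟙 (does (inP? l x)) * (𝟙 (does (covers? x y)) * f x y)) ≡⟨ ∑-cong (allSignVecs n) (λ x _ → inflow-pointwise f x yE) ⟩
    ∑ (allSignVecs n) (λ x → 𝟙 (canonical x) * ((𝟙 (restricts x y) + 𝟙 (restricts (negᵛ x) y)) * G x))
      ≡⟨ ∑-canonical-symmetric G (λ x → restricts x y) Ginv G-rank0 ⟩
    ∑ (allSignVecs n) (λ x → 𝟙 (restricts x y) * G x) ≡⟨ ∑-cong (allSignVecs n) (λ x _ → swap₂₃ (𝟙 (restricts x y)) (𝟙 (signChanges x ≤ᵇ l)) (𝟙 (suc (rankᵛ x) ≡ᵇ rankᵛ y)) (f x y)) ⟩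
    ∑ (allSignVecs n) (λ x → 𝟙 (restricts x y) * (𝟙 (suc (rankᵛ x) ≡ᵇ rankᵛ y) * (𝟙 (signChanges x ≤ᵇ l) * f x y))) ≡⟨ ∑-below-rankPred n y _ ⟩
    ∑ (deletions y) (λ x → 𝟙 (signChanges x ≤ᵇ l) * f x y) ∎
    where
    open ≡-Reasoning
    G : Vec Sign n → ℕ
    G x = 𝟙 (signChanges x ≤ᵇ l) * (𝟙 (suc (rankᵛ x) ≡ᵇ rankᵛ y) * f x y)
    Ginv : ∀ v → G (negᵛ v) ≡ G v
    Ginv v rewrite signChanges-negᵛ v | rankᵛ-negᵛ v | finv v y = refl
    G-rank0 : ∀ v → rankᵛ v ≡ 0 → G v ≡ 0
    G-rank0 v z rewrite z | 𝟙-≡ᵇ-≢ 1 (rankᵛ y) (λ e → <-irrefl e r2) = *-zeroʳ (𝟙 (signChanges v ≤ᵇ l))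
    swap₂₃ : ∀ a b c m → a * (b * (c * m)) ≡ a * (c * (b * m))
    swap₂₃ = solve-∀


change-refl : ∀ a → change a a ≡ 0
change-refl 𝟎 = refl
change-refl ⊕ = refl
change-refl ⊖ = refl

change≡0⇒≡ : ∀ a b → change a b ≡ 0 → a ≡ b
change≡0⇒≡ 𝟎 𝟎 _ = refl
change≡0⇒≡ ⊕ ⊕ _ = refl
change≡0⇒≡ ⊖ ⊖ _ = refl
change≡0⇒≡ 𝟎 ⊕ ()
change≡0⇒≡ 𝟎 ⊖ ()
change≡0⇒≡ ⊕ 𝟎 ()
change≡0⇒≡ ⊕ ⊖ ()
change≡0⇒≡ ⊖ 𝟎 ()
change≡0⇒≡ ⊖ ⊕ ()

changesFrom≡0⇒const : ∀ a L → changesFrom a L ≡ 0 → All (_≡ a) L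
changesFrom≡0⇒const a [] _ = []
changesFrom≡0⇒const a (b ∷ L) e rewrite changesFrom-∷ a b L with change a b in eq
... | zero = let ab = change≡0⇒≡ a b eq in sym ab ∷ subst (λ w → All (_≡ w) L) (sym ab) (changesFrom≡0⇒const b L e)

const⇒changesFrom≡0 : ∀ a L → All (_≡ a) L → changesFrom a L ≡ 0
const⇒changesFrom≡0 a [] _ = refl
const⇒changesFrom≡0 a (b ∷ L) (refl ∷ r) rewrite changesFrom-∷ b b L | change-refl b = const⇒changesFrom≡0 b L r

const⇒changes≡0 : ∀ a L → All (_≡ a) L → changes L ≡ 0
const⇒changes≡0 a [] _ = refl
const⇒changes≡0 a (b ∷ L) (refl ∷ r) = const⇒changesFrom≡0 b L r

changes≡0⇒const : ∀ M → changes M ≡ 0 → ∀ {a b} → a ∈ M → b ∈ M → a ≡ b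
changes≡0⇒const (h ∷ L) e {a} {b} pa pb = trans (g pa) (sym (g pb))
  where
  al : All (_≡ h) (h ∷ L)
  al = refl ∷ changesFrom≡0⇒const h L e
  g : ∀ {c} → c ∈ h ∷ L → c ≡ h
  g p = All.lookup al p

lastOf : Sign → List Sign → Sign
lastOf a [] = a
lastOf a (b ∷ L) = lastOf b L

lastOf-∈ : ∀ a L → lastOf a L ∈ a ∷ L
lastOf-∈ a [] = here refl
lastOf-∈ a (b ∷ L) = there (lastOf-∈ b L)

changesFrom-repeat : ∀ a L1 L2 → changesFrom a (L1 ++ lastOf a L1 ∷ L2) ≡ changesFrom a (L1 ++ L2)
changesFrom-repeat a [] L2 rewrite changesFrom-∷ a a L2 | change-refl a = refl
changesFrom-repeat a (b ∷ L1) L2 rewrite changesFrom-∷ a b (L1 ++ lastOf b L1 ∷ L2) | changesFrom-∷ a b (L1 ++ L2) = cong (change a b +_) (changesFrom-repeat b L1 L2)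

-- Repeating a neighbouring entry creates no sign change.
insert-sameChanges : ∀ L1 L2 → AllNonzero (L1 ++ L2) → Σ Sign λ s → (s ≡ ⊕ ⊎ s ≡ ⊖) × changes (L1 ++ s ∷ L2) ≡ changes (L1 ++ L2)
insert-sameChanges [] [] _ = ⊕ , inj₁ refl , refl
insert-sameChanges [] (b ∷ L2) (nb ∷ _) = b , pm b nb , trans (changesFrom-∷ b b L2) (cong (_+ changesFrom b L2) (change-refl b))
  where pm : ∀ b → b ≢ 𝟎 → b ≡ ⊕ ⊎ b ≡ ⊖
        pm 𝟎 n = ⊥-elim (n refl)
        pm ⊕ _ = inj₁ refl
        pm ⊖ _ = inj₂ refl
insert-sameChanges (a ∷ L1) L2 nzl = lastOf a L1 , pm (lastOf a L1) (All.lookup nzl (∈-++⁺ˡ (lastOf-∈ a L1))) , changesFrom-repeat a L1 L2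
  where pm : ∀ b → b ≢ 𝟎 → b ≡ ⊕ ⊎ b ≡ ⊖
        pm 𝟎 n = ⊥-elim (n refl)
        pm ⊕ _ = inj₁ refl
        pm ⊖ _ = inj₂ refl

flips : List Sign → List (List Sign)
flips [] = []
flips (a ∷ L) = (negˢ a ∷ L) ∷ map (a ∷_) (flips L)

length-flips : ∀ xs → length (flips xs) ≡ length xs
length-flips []       = refl
length-flips (a ∷ xs) = cong suc (trans (length-map (a ∷_) (flips xs)) (length-flips xs))

flipsChanges≤1 : Sign → List Sign → ℕ
flipsChanges≤1 a L = ∑ (flips L) (λ M → 𝟙 (changesFrom a M ≤ᵇ 1))

flipsChanges≡0 : Sign → List Sign → ℕ
flipsChanges≡0 a L = ∑ (flips L) (λ M → 𝟙 (changesFrom a M ≤ᵇ 0))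

change-cases : ∀ a c → a ≢ 𝟎 → c ≢ 𝟎 → (c ≡ a × change a c ≡ 0 × change (negˢ a) c ≡ 1) ⊎ (c ≡ negˢ a × change a c ≡ 1 × change (negˢ a) c ≡ 0)
change-cases ⊕ ⊕ _ _ = inj₁ (refl , refl , refl)
change-cases ⊕ ⊖ _ _ = inj₂ (refl , refl , refl)
change-cases ⊖ ⊖ _ _ = inj₁ (refl , refl , refl)
change-cases ⊖ ⊕ _ _ = inj₂ (refl , refl , refl)
change-cases 𝟎 c n _ = ⊥-elim (n refl)
change-cases ⊕ 𝟎 _ n = ⊥-elim (n refl)
change-cases ⊖ 𝟎 _ n = ⊥-elim (n refl)

𝟙-1+≤ᵇ1 : ∀ k → 𝟙 (1 + k ≤ᵇ 1) ≡ 𝟙 (k ≤ᵇ 0)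
𝟙-1+≤ᵇ1 zero = refl
𝟙-1+≤ᵇ1 (suc k) = refl

𝟙-≤ᵇ1 : ∀ k → k ≤ 1 → 𝟙 (k ≤ᵇ 1) ≡ 1
𝟙-≤ᵇ1 zero _ = refl
𝟙-≤ᵇ1 (suc zero) _ = refl
𝟙-≤ᵇ1 (suc (suc k)) (s≤s ())

change-negˢ≡1 : ∀ a → a ≢ 𝟎 → change a (negˢ a) ≡ 1
change-negˢ≡1 𝟎 n = ⊥-elim (n refl)
change-negˢ≡1 ⊕ _ = refl
change-negˢ≡1 ⊖ _ = refl

change≤1 : ∀ a b → change a b ≤ 1
change≤1 a b = 𝟙≤1 (not (does (a ≟ˢ b)))

negˢ-≢𝟎 : ∀ a → a ≢ 𝟎 → negˢ a ≢ 𝟎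
negˢ-≢𝟎 𝟎 n = ⊥-elim (n refl)
negˢ-≢𝟎 ⊕ _ ()
negˢ-≢𝟎 ⊖ _ ()

changesFrom-negˢ≤1 : ∀ c L → changesFrom c L ≡ 0 → changesFrom (negˢ c) L ≤ 1
changesFrom-negˢ≤1 c [] _ = z≤n
changesFrom-negˢ≤1 c (b ∷ L) e with changesFrom≡0⇒const c (b ∷ L) e
... | refl ∷ _ rewrite changesFrom-∷ c c L | change-refl c | changesFrom-∷ (negˢ c) c L = ≤-trans (≤-reflexive (cong (change (negˢ c) c +_) e)) (≤-trans (≤-reflexive (+-identityʳ _)) (change≤1 (negˢ c) c))

changesFrom≡0-after-negˢ : ∀ a L → a ≢ 𝟎 → changesFrom a (negˢ a ∷ L) ≤ 1 → changesFrom (negˢ a) L ≡ 0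
changesFrom≡0-after-negˢ a L na h = n≤0⇒n≡0 (≤-pred (subst (_≤ 1) (trans (changesFrom-∷ a (negˢ a) L) (cong (_+ changesFrom (negˢ a) L) (change-negˢ≡1 a na))) h))

flipsChanges≤1-∷ : ∀ a c L → flipsChanges≤1 a (c ∷ L) ≡ 𝟙 (change a (negˢ c) + changesFrom (negˢ c) L ≤ᵇ 1) + ∑ (flips L) (λ M → 𝟙 (change a c + changesFrom c M ≤ᵇ 1))
flipsChanges≤1-∷ a c L = cong₂ _+_ (cong (λ k → 𝟙 (k ≤ᵇ 1)) (changesFrom-∷ a (negˢ c) L))
   (trans (∑-map (c ∷_) (flips L) (λ M → 𝟙 (changesFrom a M ≤ᵇ 1))) (∑-cong (flips L) (λ M _ → cong (λ k → 𝟙 (k ≤ᵇ 1)) (changesFrom-∷ a c M))))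

flipsChanges≡0-∷ : ∀ a c L → flipsChanges≡0 a (c ∷ L) ≡ 𝟙 (change a (negˢ c) + changesFrom (negˢ c) L ≤ᵇ 0) + ∑ (flips L) (λ M → 𝟙 (change a c + changesFrom c M ≤ᵇ 0))
flipsChanges≡0-∷ a c L = cong₂ _+_ (cong (λ k → 𝟙 (k ≤ᵇ 0)) (changesFrom-∷ a (negˢ c) L))
   (trans (∑-map (c ∷_) (flips L) (λ M → 𝟙 (changesFrom a M ≤ᵇ 0))) (∑-cong (flips L) (λ M _ → cong (λ k → 𝟙 (k ≤ᵇ 0)) (changesFrom-∷ a c M))))

flipsChanges≡0-const : ∀ c L → c ≢ 𝟎 → changesFrom c L ≡ 0 → flipsChanges≡0 c L ≡ 0
flipsChanges≡0-const c [] _ _ = refl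
flipsChanges≡0-const c (b ∷ L) nc e with changesFrom≡0⇒const c (b ∷ L) e
... | refl ∷ _ rewrite flipsChanges≡0-∷ c c L | change-negˢ≡1 c nc | change-refl c | changesFrom-∷ c c L | change-refl c = flipsChanges≡0-const c L nc e

-- A nonzero sign sequence a ∷ L of length ≥ 2 with at most one sign change has
-- exactly two single-entry flips with at most one sign change: its two ends if
-- it is constant, the two entries next to the change otherwise.
flips-changes≤1 : ∀ a L → a ≢ 𝟎 → AllNonzero L → 1 ≤ length L → changesFrom a L ≤ 1 → 𝟙 (changesFrom (negˢ a) L ≤ᵇ 1) + flipsChanges≤1 a L ≡ 2
flips-changes≤1 a (c ∷ L) na (nc ∷ nzL) _ h with change-cases a c na nc
... | inj₁ (refl , e0 , e1) = begin
  𝟙 (changesFrom (negˢ a) (a ∷ L) ≤ᵇ 1) + flipsChanges≤1 a (a ∷ L)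
    ≡⟨ cong₂ _+_ (cong (λ k → 𝟙 (k ≤ᵇ 1)) (trans (changesFrom-∷ (negˢ a) a L) (cong (_+ changesFrom a L) e1))) (flipsChanges≤1-∷ a a L) ⟩
  𝟙 (1 + changesFrom a L ≤ᵇ 1) + (𝟙 (change a (negˢ a) + changesFrom (negˢ a) L ≤ᵇ 1) + ∑ (flips L) (λ M → 𝟙 (change a a + changesFrom a M ≤ᵇ 1)))
    ≡⟨ cong₂ (λ u v → 𝟙 (1 + changesFrom a L ≤ᵇ 1) + (𝟙 (u + changesFrom (negˢ a) L ≤ᵇ 1) + v)) (change-negˢ≡1 a na)
         (∑-cong (flips L) (λ M _ → cong (λ w → 𝟙 (w + changesFrom a M ≤ᵇ 1)) e0)) ⟩
  𝟙 (1 + changesFrom a L ≤ᵇ 1) + (𝟙 (1 + changesFrom (negˢ a) L ≤ᵇ 1) + flipsChanges≤1 a L)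
    ≡⟨ cong₂ (λ u v → u + (v + flipsChanges≤1 a L)) (𝟙-1+≤ᵇ1 (changesFrom a L)) (𝟙-1+≤ᵇ1 (changesFrom (negˢ a) L)) ⟩
  𝟙 (changesFrom a L ≤ᵇ 0) + (𝟙 (changesFrom (negˢ a) L ≤ᵇ 0) + flipsChanges≤1 a L) ≡⟨ rest L nzL h' ⟩
  2 ∎
  where
  open ≡-Reasoning
  h' : changesFrom a L ≤ 1
  h' = ≤-trans (≤-reflexive (sym (trans (changesFrom-∷ a a L) (cong (_+ changesFrom a L) e0)))) h
  rest : ∀ L → AllNonzero L → changesFrom a L ≤ 1 → 𝟙 (changesFrom a L ≤ᵇ 0) + (𝟙 (changesFrom (negˢ a) L ≤ᵇ 0) + flipsChanges≤1 a L) ≡ 2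
  rest [] _ _ = refl
  rest (b ∷ L') nz' hL = trans (sym (+-assoc (𝟙 (changesFrom a (b ∷ L') ≤ᵇ 0)) _ (flipsChanges≤1 a (b ∷ L'))))
     (trans (cong (_+ flipsChanges≤1 a (b ∷ L')) aux) (flips-changes≤1 a (b ∷ L') na nz' (s≤s z≤n) hL))
    where
    aux : 𝟙 (changesFrom a (b ∷ L') ≤ᵇ 0) + 𝟙 (changesFrom (negˢ a) (b ∷ L') ≤ᵇ 0) ≡ 𝟙 (changesFrom (negˢ a) (b ∷ L') ≤ᵇ 1)
    aux rewrite changesFrom-∷ a b L' | changesFrom-∷ (negˢ a) b L' with change-cases a b na (All.head nz')
    ... | inj₁ (refl , f0 , f1) rewrite f0 | f1 = trans (+-identityʳ _) (sym (𝟙-1+≤ᵇ1 (changesFrom a L')))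
    ... | inj₂ (refl , f1 , f0) rewrite f0 | f1 | n≤0⇒n≡0 (≤-pred hL) = refl
... | inj₂ (refl , e1 , e0) = begin
  𝟙 (changesFrom (negˢ a) (negˢ a ∷ L) ≤ᵇ 1) + flipsChanges≤1 a (negˢ a ∷ L)
    ≡⟨ cong₂ _+_ (cong (λ k → 𝟙 (k ≤ᵇ 1)) (trans (changesFrom-∷ (negˢ a) (negˢ a) L) (cong₂ _+_ (change-refl (negˢ a)) z))) (flipsChanges≤1-∷ a (negˢ a) L) ⟩
  1 + (𝟙 (change a (negˢ (negˢ a)) + changesFrom (negˢ (negˢ a)) L ≤ᵇ 1) + ∑ (flips L) (λ M → 𝟙 (change a (negˢ a) + changesFrom (negˢ a) M ≤ᵇ 1)))
    ≡⟨ cong (λ w → 1 + (𝟙 (change a w + changesFrom w L ≤ᵇ 1) + ∑ (flips L) (λ M → 𝟙 (change a (negˢ a) + changesFrom (negˢ a) M ≤ᵇ 1)))) (negˢ-involutive a) ⟩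
  1 + (𝟙 (change a a + changesFrom a L ≤ᵇ 1) + ∑ (flips L) (λ M → 𝟙 (change a (negˢ a) + changesFrom (negˢ a) M ≤ᵇ 1)))
    ≡⟨ cong₂ (λ u v → 1 + (𝟙 (u + changesFrom a L ≤ᵇ 1) + v)) (change-refl a)
         (∑-cong (flips L) (λ M _ → trans (cong (λ w → 𝟙 (w + changesFrom (negˢ a) M ≤ᵇ 1)) (change-negˢ≡1 a na)) (𝟙-1+≤ᵇ1 (changesFrom (negˢ a) M)))) ⟩
  1 + (𝟙 (changesFrom a L ≤ᵇ 1) + flipsChanges≡0 (negˢ a) L)
    ≡⟨ cong₂ (λ u v → 1 + (u + v)) (𝟙-≤ᵇ1 (changesFrom a L) (subst (λ w → changesFrom w L ≤ 1) (negˢ-involutive a) (changesFrom-negˢ≤1 (negˢ a) L z)))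
         (flipsChanges≡0-const (negˢ a) L (negˢ-≢𝟎 a na) z) ⟩
  2 ∎
  where
  open ≡-Reasoning
  z : changesFrom (negˢ a) L ≡ 0
  z = changesFrom≡0-after-negˢ a L na h


-- flipAt x y negates y where x is zero; for x a deletion of y it flips the
-- deleted coordinate, and for an extension y of x it gives the twin extension.
flipSign : Sign → Sign → Sign
flipSign 𝟎 b = negˢ b
flipSign ⊕ b = b
flipSign ⊖ b = b

flipAt : ∀ {n} → Vec Sign n → Vec Sign n → Vec Sign n
flipAt [] [] = []
flipAt (a ∷ x) (b ∷ y) = flipSign a b ∷ flipAt x y

flipAt-negᵛˡ : ∀ {n} (x y : Vec Sign n) → flipAt (negᵛ x) y ≡ flipAt x y
flipAt-negᵛˡ [] [] = refl
flipAt-negᵛˡ (𝟎 ∷ x) (b ∷ y) = cong (negˢ b ∷_) (flipAt-negᵛˡ x y)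
flipAt-negᵛˡ (⊕ ∷ x) (b ∷ y) = cong (b ∷_) (flipAt-negᵛˡ x y)
flipAt-negᵛˡ (⊖ ∷ x) (b ∷ y) = cong (b ∷_) (flipAt-negᵛˡ x y)

flipAt-negᵛʳ : ∀ {n} (x y : Vec Sign n) → flipAt x (negᵛ y) ≡ negᵛ (flipAt x y)
flipAt-negᵛʳ [] [] = refl
flipAt-negᵛʳ (𝟎 ∷ x) (b ∷ y) = cong (negˢ (negˢ b) ∷_) (flipAt-negᵛʳ x y)
flipAt-negᵛʳ (⊕ ∷ x) (b ∷ y) = cong (negˢ b ∷_) (flipAt-negᵛʳ x y)
flipAt-negᵛʳ (⊖ ∷ x) (b ∷ y) = cong (negˢ b ∷_) (flipAt-negᵛʳ x y)

flipAt-self : ∀ {n} (x : Vec Sign n) → flipAt x x ≡ x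
flipAt-self [] = refl
flipAt-self (𝟎 ∷ x) = cong (𝟎 ∷_) (flipAt-self x)
flipAt-self (⊕ ∷ x) = cong (⊕ ∷_) (flipAt-self x)
flipAt-self (⊖ ∷ x) = cong (⊖ ∷_) (flipAt-self x)


extensionPair-flip : ∀ {n} (x : Vec Sign n) {u v} → (u , v) ∈ extensionPairs x → flipAt x u ≡ v × flipAt x v ≡ u
extensionPair-flip (𝟎 ∷ x) (here refl) = cong (⊖ ∷_) (flipAt-self x) , cong (⊕ ∷_) (flipAt-self x)
extensionPair-flip (𝟎 ∷ x) (there p) with ∈-map⁻ (consPair 𝟎) p
... | (u' , v') , q , refl = cong (𝟎 ∷_) (proj₁ (extensionPair-flip x q)) , cong (𝟎 ∷_) (proj₂ (extensionPair-flip x q))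
extensionPair-flip (⊕ ∷ x) p with ∈-map⁻ (consPair ⊕) p
... | (u' , v') , q , refl = cong (⊕ ∷_) (proj₁ (extensionPair-flip x q)) , cong (⊕ ∷_) (proj₂ (extensionPair-flip x q))
extensionPair-flip (⊖ ∷ x) p with ∈-map⁻ (consPair ⊖) p
... | (u' , v') , q , refl = cong (⊖ ∷_) (proj₁ (extensionPair-flip x q)) , cong (⊖ ∷_) (proj₂ (extensionPair-flip x q))

extensionPair-nonzeros : ∀ {n} (x : Vec Sign n) {u v} → (u , v) ∈ extensionPairs x →
            Σ (List Sign) λ L1 → Σ (List Sign) λ L2 → nonzeros x ≡ L1 ++ L2 × nonzeros u ≡ L1 ++ ⊕ ∷ L2 × nonzeros v ≡ L1 ++ ⊖ ∷ L2
extensionPair-nonzeros (𝟎 ∷ x) (here refl) = [] , nonzeros x , refl , refl , refl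
extensionPair-nonzeros (𝟎 ∷ x) (there p) with ∈-map⁻ (consPair 𝟎) p
... | (u' , v') , q , refl = extensionPair-nonzeros x q
extensionPair-nonzeros (⊕ ∷ x) p with ∈-map⁻ (consPair ⊕) p
... | (u' , v') , q , refl with extensionPair-nonzeros x q
...   | L1 , L2 , a , b , c = ⊕ ∷ L1 , L2 , cong (⊕ ∷_) a , cong (⊕ ∷_) b , cong (⊕ ∷_) c
extensionPair-nonzeros (⊖ ∷ x) p with ∈-map⁻ (consPair ⊖) p
... | (u' , v') , q , refl with extensionPair-nonzeros x q
...   | L1 , L2 , a , b , c = ⊖ ∷ L1 , L2 , cong (⊖ ∷_) a , cong (⊖ ∷_) b , cong (⊖ ∷_) c

deletions-restrict : ∀ {n} (y : Vec Sign n) {z} → z ∈ deletions y → restricts z y ≡ true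
deletions-restrict (𝟎 ∷ y) p with ∈-map⁻ (𝟎 ∷_) p
... | z' , q , refl = deletions-restrict y q
deletions-restrict (⊕ ∷ y) (here refl) = restricts-refl y
deletions-restrict (⊕ ∷ y) (there p) with ∈-map⁻ (⊕ ∷_) p
... | z' , q , refl = deletions-restrict y q
deletions-restrict (⊖ ∷ y) (here refl) = restricts-refl y
deletions-restrict (⊖ ∷ y) (there p) with ∈-map⁻ (⊖ ∷_) p
... | z' , q , refl = deletions-restrict y q

∑-deletions-flipAt : ∀ {n} (y : Vec Sign n) (H : List Sign → ℕ) → ∑ (deletions y) (λ z → H (nonzeros (flipAt z y))) ≡ ∑ (flips (nonzeros y)) H
∑-deletions-flipAt [] H = refl
∑-deletions-flipAt (𝟎 ∷ y) H = trans (∑-map (𝟎 ∷_) (deletions y) _) (∑-deletions-flipAt y H)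
∑-deletions-flipAt (⊕ ∷ y) H = cong₂ _+_ (cong (λ w → H (⊖ ∷ nonzeros w)) (flipAt-self y))
   (trans (∑-map (⊕ ∷_) (deletions y) _) (trans (∑-deletions-flipAt y (λ M → H (⊕ ∷ M))) (sym (∑-map (⊕ ∷_) (flips (nonzeros y)) H))))
∑-deletions-flipAt (⊖ ∷ y) H = cong₂ _+_ (cong (λ w → H (⊕ ∷ nonzeros w)) (flipAt-self y))
   (trans (∑-map (⊖ ∷_) (deletions y) _) (trans (∑-deletions-flipAt y (λ M → H (⊖ ∷ M))) (sym (∑-map (⊖ ∷_) (flips (nonzeros y)) H))))

-- The three flows

𝟙-≤ᵇ : ∀ k m → k ≤ m → 𝟙 (k ≤ᵇ m) ≡ 1
𝟙-≤ᵇ k m p = cong 𝟙 (T⇒≡true (≤⇒≤ᵇ p))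

module SignFlow (n l : ℕ) where
  open SignPoset n l public

  isRanked : IsRanked (P n l)
  isRanked = record
    { rank-bounds = Elems-rankᵛ
    ; ⊑-trans     = λ {x} {y} {z} _ _ _ x≤y y≤z →
                      Below⇒SignLeq x z (Below-trans x y z (SignLeq⇒Below x y x≤y) (SignLeq⇒Below y z y≤z))
    ; ⋖⇒rank-suc  = Covers⇒rankᵛ-suc
    }

  -- An element of P n l is the canonical one of its two representatives, so a
  -- flow given on sign vectors must not depend on the choice of representative.
  integralFlow : (f : Vec Sign n → Vec Sign n → ℕ) → (∀ x y → f x (negᵛ y) ≡ f x y) → (∀ x y → f (negᵛ x) y ≡ f x y) →
                 (up down : ℕ → ℕ) → (∀ r → r < n → 0 < up r) → (∀ r → 1 ≤ r → 0 < down r) →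
                 (∀ {x} → x ∈ Elems → rankᵛ x < n →
                    ∑ (extensionPairs x) (pairSum (λ y → 𝟙 (signChanges y ≤ᵇ l) * f x y)) ≡ up (rankᵛ x)) →
                 (∀ {y} r → y ∈ Elems → rankᵛ y ≡ suc r → 1 ≤ r →
                    ∑ (deletions y) (λ x → 𝟙 (signChanges x ≤ᵇ l) * f x y) ≡ down r) →
                 IntegralFlow (P n l)
  integralFlow f f-negʳ f-negˡ up down up-pos down-pos outflow inflow = record
    { flow = f ; up = up ; down = down ; up-pos = up-pos ; down-pos = down-pos
    ; outflow = λ xE r<n → trans (outflow≡∑extensions f f-negʳ xE) (outflow xE r<n)
    ; inflow  = λ r yE e 1≤r → trans (inflow≡∑deletions f f-negˡ yE (subst (2 ≤_) (sym e) (s≤s 1≤r))) (inflow r yE e 1≤r)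
    }

  deletion∈P : ∀ {y} → y ∈ Elems → ∀ {z} → z ∈ deletions y → 𝟙 (signChanges z ≤ᵇ l) ≡ 1
  deletion∈P {y} yE {z} p =
    𝟙-≤ᵇ (signChanges z) l (≤-trans (restricts⇒signChanges-≤ z y (deletions-restrict y p)) (Elems-signChanges yE))

  ∑-deletions-1 : ∀ {y} → y ∈ Elems → ∑ (deletions y) (λ x → 𝟙 (signChanges x ≤ᵇ l) * 1) ≡ rankᵛ y
  ∑-deletions-1 {y} yE = begin
    ∑ (deletions y) (λ x → 𝟙 (signChanges x ≤ᵇ l) * 1) ≡⟨ ∑-cong (deletions y) (λ z p → cong (_* 1) (deletion∈P yE p)) ⟩
    ∑ (deletions y) (λ _ → 1)                          ≡⟨ ∑-1 (deletions y) ⟩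
    length (deletions y)                               ≡⟨ length-deletions y ⟩
    rankᵛ y ∎
    where open ≡-Reasoning

  ∑-extensionPairs-const : ∀ {x} (g : Vec Sign n × Vec Sign n → ℕ) k → (∀ p → p ∈ extensionPairs x → g p ≡ k) →
                           ∑ (extensionPairs x) g ≡ (n ∸ rankᵛ x) * k
  ∑-extensionPairs-const {x} g k g≡k =
    trans (∑-cong (extensionPairs x) g≡k) (trans (∑-const (extensionPairs x) k) (cong (_* k) (length-extensionPairs x)))

module AnyChanges (n : ℕ) where
  open SignFlow n (n ∸ 1)

  every-signVec∈P : ∀ (y : Vec Sign n) → 𝟙 (signChanges y ≤ᵇ (n ∸ 1)) ≡ 1
  every-signVec∈P y = 𝟙-≤ᵇ (signChanges y) (n ∸ 1) (≤-trans (changes≤length∸1 (nonzeros y)) (∸-monoˡ-≤ 1 (rankᵛ≤n y)))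

  flow : IntegralFlow (P n (n ∸ 1))
  flow = integralFlow (λ _ _ → 1) (λ _ _ → refl) (λ _ _ → refl) (λ r → (n ∸ r) * 2) suc
    (λ r r<n → *-pos (m<n⇒0<n∸m r<n) (s≤s z≤n)) (λ r _ → s≤s z≤n)
    (λ {x} xE _ → ∑-extensionPairs-const {x} (pairSum (λ y → 𝟙 (signChanges y ≤ᵇ (n ∸ 1)) * 1)) 2
                    (λ (u , v) _ → cong₂ _+_ (cong (_* 1) (every-signVec∈P u)) (cong (_* 1) (every-signVec∈P v))))
    (λ r yE e _ → trans (∑-deletions-1 yE) e)

module NoChange (n : ℕ) where
  open SignFlow n 0

  ⊕∈nonzeros : ∀ {x} → x ∈ Elems → ⊕ ∈ nonzeros x
  ⊕∈nonzeros {x} xE with nonzeros x | canonical⇒IsCanonical x (Elems-canonical xE)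
  ... | a ∷ _ | refl = here refl

  all⊕ : ∀ {x} → x ∈ Elems → ∀ {s} → s ∈ nonzeros x → s ≡ ⊕
  all⊕ {x} xE p = changes≡0⇒const (nonzeros x) (n≤0⇒n≡0 (Elems-signChanges xE)) p (⊕∈nonzeros xE)

  ∈-insert : ∀ (xs ys : List Sign) b {a} → a ∈ xs ++ ys → a ∈ xs ++ b ∷ ys
  ∈-insert xs ys b p with ∈-++⁻ xs p
  ... | inj₁ q = ∈-++⁺ˡ q
  ... | inj₂ q = ∈-++⁺ʳ xs (there q)

  𝟙-≤ᵇ0 : ∀ k → k ≢ 0 → 𝟙 (k ≤ᵇ 0) ≡ 0
  𝟙-≤ᵇ0 zero    k≢0 = ⊥-elim (k≢0 refl)
  𝟙-≤ᵇ0 (suc k) _   = refl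

  -- Of the two ways to extend an all-⊕ vector, exactly the ⊕ one stays in P n 0.
  exactlyOne∈P : ∀ {x} → x ∈ Elems → ∀ {u v} → (u , v) ∈ extensionPairs x →
                 𝟙 (signChanges u ≤ᵇ 0) * 1 + 𝟙 (signChanges v ≤ᵇ 0) * 1 ≡ 1
  exactlyOne∈P {x} xE {u} {v} p with xs , ys , x≡ , u≡ , v≡ ← extensionPair-nonzeros x p =
    cong₂ _+_ (cong (_* 1) (𝟙-≤ᵇ (signChanges u) 0 (≤-reflexive u-const))) (cong (_* 1) (𝟙-≤ᵇ0 (signChanges v) v-nonconst))
    where
    ⊕-around : ∀ {s} → s ∈ xs ++ ys → s ≡ ⊕
    ⊕-around q = all⊕ xE (subst (_ ∈_) (sym x≡) q)
    all⊕-u : All (_≡ ⊕) (xs ++ ⊕ ∷ ys)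
    all⊕-u = All.tabulate λ q → case-∈ (∈-++⁻ xs q)
      where
      case-∈ : ∀ {s} → s ∈ xs ⊎ s ∈ ⊕ ∷ ys → s ≡ ⊕
      case-∈ (inj₁ q)         = ⊕-around (∈-++⁺ˡ q)
      case-∈ (inj₂ (here e))  = e
      case-∈ (inj₂ (there q)) = ⊕-around (∈-++⁺ʳ xs q)
    u-const : signChanges u ≡ 0
    u-const = trans (cong changes u≡) (const⇒changes≡0 ⊕ _ all⊕-u)
    v-nonconst : signChanges v ≢ 0
    v-nonconst e with changes≡0⇒const (nonzeros v) e (subst (⊖ ∈_) (sym v≡) (∈-++⁺ʳ xs (here refl)))
                        (subst (⊕ ∈_) (sym v≡) (∈-insert xs ys ⊖ (subst (⊕ ∈_) x≡ (⊕∈nonzeros xE))))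
    ... | ()

  flow : IntegralFlow (P n 0)
  flow = integralFlow (λ _ _ → 1) (λ _ _ → refl) (λ _ _ → refl) (λ r → (n ∸ r) * 1) suc
    (λ r r<n → *-pos (m<n⇒0<n∸m r<n) (s≤s z≤n)) (λ r _ → s≤s z≤n)
    (λ {x} xE _ → ∑-extensionPairs-const {x} (pairSum (λ y → 𝟙 (signChanges y ≤ᵇ 0) * 1)) 1 (λ _ p → exactlyOne∈P xE p))
    (λ r yE e _ → trans (∑-deletions-1 yE) e)

twinWeight : Bool → ℕ
twinWeight true  = 1
twinWeight false = 2

twinWeight+𝟙 : ∀ b → twinWeight b + 𝟙 b ≡ 2
twinWeight+𝟙 true  = refl
twinWeight+𝟙 false = refl

module OneChange (n : ℕ) where
  open SignFlow n 1

  fewChanges : Vec Sign n → Bool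
  fewChanges w = signChanges w ≤ᵇ 1

  f : Vec Sign n → Vec Sign n → ℕ
  f x y = twinWeight (fewChanges (flipAt x y))

  f-negʳ : ∀ x y → f x (negᵛ y) ≡ f x y
  f-negʳ x y = trans (cong (λ w → twinWeight (fewChanges w)) (flipAt-negᵛʳ x y))
                     (cong (λ k → twinWeight (k ≤ᵇ 1)) (signChanges-negᵛ (flipAt x y)))

  f-negˡ : ∀ x y → f (negᵛ x) y ≡ f x y
  f-negˡ x y = cong (λ w → twinWeight (fewChanges w)) (flipAt-negᵛˡ x y)

  twins-outflow : ∀ a b → (a ≡ true ⊎ b ≡ true) → 𝟙 a * twinWeight b + 𝟙 b * twinWeight a ≡ 2
  twins-outflow true  true  _ = refl
  twins-outflow true  false _ = refl
  twins-outflow false true  _ = refl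
  twins-outflow false false (inj₁ ())
  twins-outflow false false (inj₂ ())

  -- One of the two signs can be inserted without creating a sign change.
  twins-outflow≡2 : ∀ {x} → x ∈ Elems → ∀ {u v} → (u , v) ∈ extensionPairs x → 𝟙 (fewChanges u) * f x u + 𝟙 (fewChanges v) * f x v ≡ 2
  twins-outflow≡2 {x} xE {u} {v} p with extensionPair-flip x p | extensionPair-nonzeros x p
  ... | flip-u , flip-v | xs , ys , x≡ , u≡ , v≡ rewrite flip-u | flip-v = twins-outflow (fewChanges u) (fewChanges v) one∈P
    where
    one∈P : fewChanges u ≡ true ⊎ fewChanges v ≡ true
    one∈P with insert-sameChanges xs ys (subst AllNonzero x≡ (nonzeros-allNonzero x))
    ... | _ , inj₁ refl , e = inj₁ (T⇒≡true (≤⇒≤ᵇ (subst (_≤ 1) (sym (trans (cong changes u≡) (trans e (cong changes (sym x≡))))) (Elems-signChanges xE))))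
    ... | _ , inj₂ refl , e = inj₂ (T⇒≡true (≤⇒≤ᵇ (subst (_≤ 1) (sym (trans (cong changes v≡) (trans e (cong changes (sym x≡))))) (Elems-signChanges xE))))

  fewChanges-flips : ∀ {y} → y ∈ Elems → 2 ≤ rankᵛ y → ∑ (flips (nonzeros y)) (λ M → 𝟙 (changes M ≤ᵇ 1)) ≡ 2
  fewChanges-flips {y} yE 2≤r with nonzeros y | nonzeros-allNonzero y | Elems-signChanges yE
  ... | a ∷ L | a≢0 ∷ L≢0 | ≤1 = trans (cong (𝟙 (changesFrom (negˢ a) L ≤ᵇ 1) +_) (∑-map (a ∷_) (flips L) _)) (flips-changes≤1 a L a≢0 L≢0 (≤-pred 2≤r) ≤1)

  inflow≡ : ∀ {y} r → y ∈ Elems → rankᵛ y ≡ suc r → 1 ≤ r → ∑ (deletions y) (λ x → 𝟙 (signChanges x ≤ᵇ 1) * f x y) ≡ r * 2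
  inflow≡ {y} r yE e 1≤r = +-cancelʳ-≡ 2 _ _ (begin
    ∑ (deletions y) (λ x → 𝟙 (signChanges x ≤ᵇ 1) * f x y) + 2
      ≡⟨ cong₂ _+_ (∑-cong (deletions y) (λ z p → trans (cong (_* f z y) (deletion∈P yE p)) (+-identityʳ _)))
                   (sym (fewChanges-flips yE (subst (2 ≤_) (sym e) (s≤s 1≤r)))) ⟩
    ∑ (deletions y) (λ z → twinWeight (changes (nonzeros (flipAt z y)) ≤ᵇ 1)) + ∑ Fy (λ M → 𝟙 (changes M ≤ᵇ 1))
      ≡⟨ cong (_+ ∑ Fy (λ M → 𝟙 (changes M ≤ᵇ 1))) (∑-deletions-flipAt y (λ M → twinWeight (changes M ≤ᵇ 1))) ⟩
    ∑ Fy (λ M → twinWeight (changes M ≤ᵇ 1)) + ∑ Fy (λ M → 𝟙 (changes M ≤ᵇ 1)) ≡⟨ sym (∑-+ Fy _ _) ⟩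
    ∑ Fy (λ M → twinWeight (changes M ≤ᵇ 1) + 𝟙 (changes M ≤ᵇ 1))            ≡⟨ ∑-cong Fy (λ M _ → twinWeight+𝟙 (changes M ≤ᵇ 1)) ⟩
    ∑ Fy (λ _ → 2)                                                        ≡⟨ ∑-const Fy 2 ⟩
    length Fy * 2                                                         ≡⟨ cong (_* 2) (trans (length-flips (nonzeros y)) e) ⟩
    suc r * 2                                                             ≡⟨ +-comm 2 (r * 2) ⟩
    r * 2 + 2 ∎)
    where
    open ≡-Reasoning
    Fy = flips (nonzeros y)

  flow : IntegralFlow (P n 1)
  flow = integralFlow f f-negʳ f-negˡ (λ r → (n ∸ r) * 2) (λ r → r * 2)
    (λ r r<n → *-pos (m<n⇒0<n∸m r<n) (s≤s z≤n)) (λ r 1≤r → *-pos 1≤r (s≤s z≤n))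
    (λ {x} xE _ → ∑-extensionPairs-const {x} (pairSum (λ y → 𝟙 (signChanges y ≤ᵇ 1) * f x y)) 2 (λ _ p → twins-outflow≡2 xE p))
    inflow≡

proposition5p4 : (∀ (n : ℕ) → 1 ≤ n → HasNormalizedFlow (P n 0) × StronglySperner (P n 0)) ×
    (∀ (n : ℕ) → 2 ≤ n → HasNormalizedFlow (P n 1) × StronglySperner (P n 1)) ×
    (∀ (n : ℕ) → 1 ≤ n → HasNormalizedFlow (P n (n ∸ 1)) × StronglySperner (P n (n ∸ 1)))
proposition5p4 =
  (λ n _ → normalizedFlow×stronglySperner (SignFlow.isRanked n 0) (NoChange.flow n)) ,
  (λ n _ → normalizedFlow×stronglySperner (SignFlow.isRanked n 1) (OneChange.flow n)) ,
  (λ n _ → normalizedFlow×stronglySperner (SignFlow.isRanked n (n ∸ 1)) (AnyChanges.flow n))
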